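{- Fix a finite set $Q$ of states. Let $\Gamma$ be a context, $t$ a simply-typed $\lambda$-term, $\sigma$ a quantitative refined type and $\kappa$ a simple type. (1) If $\Gamma \vdash t : \sigma :: \kappa$ is derivable in the quantitative intersection type system, then $\lfloor \Gamma \rfloor \vdash t : \lfloor \sigma \rfloor :: \kappa$ is derivable in Kobayashi's intersection type system. (2) If $x_1 : \sigma_1 :: \kappa_1, \ldots, x_n : \sigma_n :: \kappa_n \vdash t : \tau :: \kappa$ is derivable in Kobayashi's intersection type system, then there exist quantitative refined types $\hat{\sigma}_1,\ldots,\hat{\sigma}_n,\hat{\tau}$ such that: $\hat{\sigma}_i :: \kappa_i$ for all $1\le i\le n$ and $\hat{\tau} :: \kappa$; $\lfloor \hat{\sigma}_i \rfloor \preccurlyeq \sigma_i$ for all $1 \le i \le n$ and $\lfloor \hat{\tau} \rfloor \preccurlyeq \tau$; and $x_1 : \hat{\sigma}_1 :: \kappa_1, \ldots, x_n : \hat{\sigma}_n :: \kappa_n \vdash t : \hat{\tau} :: \kappa$ is derivable in the quantitative intersection type system. Moreover, both translations of derivations are effective.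
   Context: Simple types: $\kappa ::= o \mid \kappa \to \kappa'$. Fix a finite set $Q$ of states. Refined pre-types: $\sigma,\tau ::= q \mid \tau \to \sigma \mid \bigwedge_{j \in J} \tau_j$ with $q \in Q$ and $J$ finite. Refinement relation $\sigma :: \kappa$: $q :: o$ for every $q\in Q$; if $\tau_j :: \kappa$ for all $j \in J$ and $\sigma :: \kappa'$ then $(\bigwedge_{j\in J}\tau_j) \to \sigma :: \kappa \to \kappa'$. A refined type is a pre-type refining some simple type. Sequents have the form $x_1:\tau_1::\kappa_1,\ldots,x_n:\tau_n::\kappa_n \vdash M : \sigma :: \kappa$ with distinct variables; terms are simply-typed $\lambda$-terms (taken in $\beta\eta$-long normal form). Kobayashi's system (qualitative): intersections are idempotent, i.e. identified up to surjective reindexing: $\bigwedge_{j\in J}\sigma_{f(j)} = \bigwedge_{i \in I}\sigma_i$ for every surjection $f : J \to I$. Rules: (Axiom) if $\tau_j :: \kappa$ for all $j\in J$ and $i \in J$, then $\Gamma, x : \bigwedge_{j\in J}\tau_j :: \kappa \vdash x : \tau_i :: \kappa$. (Application) from $\Gamma \vdash M : (\bigwedge_{j\in J}\tau_j)\to\sigma :: \kappa\to\kappa'$ and $\Gamma \vdash N : \tau_j :: \kappa$ for all $j\in J$, infer $\Gamma \vdash M N : \sigma :: \kappa'$. (Lambda) from $\Gamma, x:\bigwedge_{j\in J}\tau_j::\kappa \vdash M : \sigma :: \kappa'$ infer $\Gamma \vdash \lambda x.M : (\bigwedge_{j\in J}\tau_j)\to\sigma :: \kappa\to\kappa'$. Quantitative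 system: intersections $\bigwedge_{j\in J}\tau_j$ are formal families, not quotiented by anything (not idempotent, not even associative/commutative or stable under bijective reindexing). A refined type is linear if it is of the form $q$ or $(\bigwedge_{i}\tau_i)\to\sigma$. Rules: (Axiom) for $q\in Q$: $x : q :: o \vdash x : q :: o$. (Left $\bigwedge$) from $\Gamma, x:\tau::\kappa \vdash M:\sigma::\kappa'$ infer $\Gamma, x : \bigwedge_{j\in\{i\}}\tau_j :: \kappa \vdash M:\sigma::\kappa'$, where $i \in \mathbb{N}$ and $\tau_i = \tau$. (Right $\bigwedge$) from $\Gamma_j \vdash M : \tau_j :: \kappa$ for all $j\in J$ infer $\bigwedge_{j\in J}\Gamma_j \vdash M : \bigwedge_{j\in J}\tau_j :: \kappa$, where $\bigwedge_{j\in J}\Gamma_j$ is the componentwise intersection of the contexts. (Left $\to$) from $\Gamma_1 \vdash N : \bigwedge_{j\in J}\tau_j :: \kappa$ and $\Gamma_2, x:\sigma::\kappa' \vdash M : \alpha :: \kappa''$ with $\sigma$ linear, infer $\Gamma_1,\Gamma_2, f : (\bigwedge_{j\in J}\tau_j)\to\sigma :: \kappa\to\kappa' \vdash M[x := f\,N] : \alpha :: \kappa''$. (Right $\to$) from $\Gamma, x:\bigwedge_{j\in J}\tau_j::\kappa \vdash M:\sigma::\kappa'$ infer $\Gamma \vdash \lambda x.M : (\bigwedge_{j\in J}\tau_j)\to\sigma :: \kappa\to\kappa'$. (Weakening) if $x \notin \Gamma$, from $\Gamma\vdash M:\sigma::\kappa'$ infer $\Gamma, x : \bigwedge_{j\in\emptyset}\tau_j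 :: \kappa \vdash M:\sigma::\kappa'$. (Contraction) if $x\notin\Gamma$, from $\Gamma, y:\bigwedge_{i\in I}\tau_i::\kappa, z:\bigwedge_{j\in J}\tau_j::\kappa \vdash M:\sigma::\kappa'$ infer $\Gamma, x:\bigwedge_{k\in I\uplus J}\tau_k::\kappa \vdash M[y,z:=x]:\sigma::\kappa'$. Collapse: for a quantitative type $\sigma$, $\lfloor\sigma\rfloor$ is the qualitative type obtained by imposing stability under surjective reindexing (idempotency); extended to contexts componentwise. Order $\preccurlyeq$ on qualitative types (Scott model order): if $\sigma::o$ and $\tau::o$ then $\sigma\preccurlyeq\tau$ iff $\sigma=\tau$; and $\bigwedge_{i\in I}\sigma_i\to\tau \preccurlyeq \bigwedge_{j\in J}\sigma'_j\to\tau'$ iff both refine the same simple type $\kappa\to\kappa'$, $\tau\preccurlyeq\tau'$, and for every $i\in I$ there is $j\in J$ with $\sigma'_j \preccurlyeq \sigma_i$. -}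

module Defs where

open import Data.Nat using (ℕ; zero; suc; _≟_)
open import Data.List using (List; []; _∷_; [_]; _++_; map; zipWith)
open import Data.List.Membership.Propositional using (_∈_; _∉_)
open import Data.List.Relation.Unary.All using (All)
open import Data.List.Relation.Unary.Any using (Any)
open import Data.List.Relation.Unary.Unique.Propositional using (Unique)
open import Data.List.Relation.Binary.Permutation.Propositional using (_↭_)
open import Data.Product using (Σ; _×_; _,_; proj₁)
open import Relation.Binary.PropositionalEquality using (_≡_)
open import Relation.Nullary using (yes; no)

data SType : Set where
  o   : SType
  _↣_ : SType → SType → SType

infixr 5 _↣_

-- λ-terms, locally nameless (free variables are names in ℕ, bound
-- variables are de Bruijn indices).  This represents terms up to α.

data Tm : Set where
  fvar : ℕ → Tm
  bvar : ℕ → Tm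
  app  : Tm → Tm → Tm
  lam  : Tm → Tm

fv : Tm → List ℕ
fv (fvar x)  = x ∷ []
fv (bvar _)  = []
fv (app t u) = fv t ++ fv u
fv (lam t)   = fv t

closeAt : ℕ → ℕ → Tm → Tm
closeAt k x (fvar y) with x ≟ y
... | yes _ = bvar k
... | no  _ = fvar y
closeAt k x (bvar i)  = bvar i
closeAt k x (app t u) = app (closeAt k x t) (closeAt k x u)
closeAt k x (lam t)   = lam (closeAt (suc k) x t)

openAt : ℕ → Tm → Tm → Tm
openAt k u (fvar y)  = fvar y
openAt k u (bvar i) with i ≟ k
... | yes _ = u
... | no  _ = bvar i
openAt k u (app t v) = app (openAt k u t) (openAt k u v)
openAt k u (lam t)   = lam (openAt (suc k) u t)

Λ : ℕ → Tm → Tm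
Λ x M = lam (closeAt 0 x M)

-- substitution M[x := N] of a free variable (capture-free: bound
-- variables are indices)
substTm : ℕ → Tm → Tm → Tm
substTm x N (fvar y) with x ≟ y
... | yes _ = N
... | no  _ = fvar y
substTm x N (bvar i)  = bvar i
substTm x N (app t u) = app (substTm x N t) (substTm x N u)
substTm x N (lam t)   = lam (substTm x N t)

SCtx : Set
SCtx = List (ℕ × SType)

names : ∀ {A : Set} → List (ℕ × A) → List ℕ
names = map proj₁

mutual
  data Neutral (Δ : SCtx) : Tm → SType → Set where
    nvar : ∀ {x κ} → (x , κ) ∈ Δ → Neutral Δ (fvar x) κ
    napp : ∀ {t u κ κ'} → Neutral Δ t (κ ↣ κ') → LNF Δ u κ → Neutral Δ (app t u) κ'

  data LNF (Δ : SCtx) : Tm → SType → Set where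
    lnf-o   : ∀ {t} → Neutral Δ t o → LNF Δ t o
    lnf-lam : ∀ {t κ κ'} (x : ℕ) → x ∉ names Δ → x ∉ fv t →
              LNF ((x , κ) ∷ Δ) (openAt 0 (fvar x) t) κ' → LNF Δ (lam t) (κ ↣ κ')

-- Quantitative refined types over a set of states Q.
-- Intersections ⋀_{j∈J} τ_j are formal families, represented as lists.

data QTy (Q : Set) : Set where
  base : Q → QTy Q
  _⇒_  : List (QTy Q) → QTy Q → QTy Q

data QPre (Q : Set) : Set where
  lin : QTy Q → QPre Q
  ⋀   : List (QTy Q) → QPre Q

data _∶∶_ {Q : Set} : QTy Q → SType → Set where
  base∶∶ : ∀ {q} → base q ∶∶ o
  arr∶∶  : ∀ {A σ κ κ'} → All (_∶∶ κ) A → σ ∶∶ κ' → (A ⇒ σ) ∶∶ (κ ↣ κ')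

_∶∶ᵖ_ : {Q : Set} → QPre Q → SType → Set
lin τ ∶∶ᵖ κ = τ ∶∶ κ
⋀ A   ∶∶ᵖ κ = All (_∶∶ κ) A

QCtx : Set → Set
QCtx Q = List (ℕ × QPre Q × SType)

sdomQ : {Q : Set} → QCtx Q → SCtx
sdomQ = map (λ { (x , _ , κ) → (x , κ) })

asList : {Q : Set} → QPre Q → List (QTy Q)
asList (lin τ) = τ ∷ []
asList (⋀ A)   = A

-- the context ⋀_{j∈{i}} Γ  (one premise)
toInt : {Q : Set} → QCtx Q → QCtx Q
toInt = map (λ { (x , p , κ) → (x , ⋀ (asList p) , κ) })

-- componentwise intersection of two contexts with the same domain
merge : {Q : Set} → QCtx Q → QCtx Q → QCtx Q
merge = zipWith (λ { (x , p , κ) (_ , p' , _) → (x , ⋀ (asList p ++ asList p') , κ) })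

mutual
  data _⊢_∶_∶∶_ {Q : Set} : QCtx Q → Tm → QPre Q → SType → Set where
    ax      : ∀ {x q} → ((x , lin (base q) , o) ∷ []) ⊢ fvar x ∶ lin (base q) ∶∶ o
    left∧   : ∀ {Γ x τ κ M σ κ'} →
              ((x , lin τ , κ) ∷ Γ) ⊢ M ∶ σ ∶∶ κ' →
              ((x , ⋀ (τ ∷ []) , κ) ∷ Γ) ⊢ M ∶ σ ∶∶ κ'
    right∧  : ∀ {Γ M A κ} → Conj M κ Γ A → Γ ⊢ M ∶ ⋀ A ∶∶ κ
    right∧∅ : ∀ {M κ} → [] ⊢ M ∶ ⋀ [] ∶∶ κ
    left→   : ∀ {Γ₁ Γ₂ N A κ x σ κ' M α κ'' f} →
              Γ₁ ⊢ N ∶ ⋀ A ∶∶ κ →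
              ((x , lin σ , κ') ∷ Γ₂) ⊢ M ∶ α ∶∶ κ'' →
              All (_∉ names Γ₂) (names Γ₁) → f ∉ names Γ₁ → f ∉ names Γ₂ →
              (Γ₁ ++ Γ₂ ++ ((f , lin (A ⇒ σ) , κ ↣ κ') ∷ []))
                ⊢ substTm x (app (fvar f) N) M ∶ α ∶∶ κ''
    right→  : ∀ {Γ x A κ M σ κ'} →
              ((x , ⋀ A , κ) ∷ Γ) ⊢ M ∶ lin σ ∶∶ κ' →
              Γ ⊢ Λ x M ∶ lin (A ⇒ σ) ∶∶ (κ ↣ κ')
    weak    : ∀ {Γ x κ M σ κ'} → x ∉ names Γ →
              Γ ⊢ M ∶ σ ∶∶ κ' →
              ((x , ⋀ [] , κ) ∷ Γ) ⊢ M ∶ σ ∶∶ κ'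
    contr   : ∀ {Γ x y z A B κ M σ κ'} → x ∉ names Γ →
              ((y , ⋀ A , κ) ∷ (z , ⋀ B , κ) ∷ Γ) ⊢ M ∶ σ ∶∶ κ' →
              ((x , ⋀ (A ++ B) , κ) ∷ Γ) ⊢ substTm y (fvar x) (substTm z (fvar x) M) ∶ σ ∶∶ κ'
    -- contexts are finite maps: order of the list is immaterial
    exch    : ∀ {Γ Γ' M σ κ} → Γ ⊢ M ∶ σ ∶∶ κ → Γ ↭ Γ' → Γ' ⊢ M ∶ σ ∶∶ κ

  -- the premises Γ_j ⊢ M : τ_j :: κ (j ∈ J, J ≠ ∅) of Right ⋀,
  -- indexed by their componentwise intersection and the family (τ_j)
  data Conj {Q : Set} (M : Tm) (κ : SType) : QCtx Q → List (QTy Q) → Set where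
    one  : ∀ {Γ τ} → Γ ⊢ M ∶ lin τ ∶∶ κ → Conj M κ (toInt Γ) (τ ∷ [])
    more : ∀ {Γ Δ τ A} → Γ ⊢ M ∶ lin τ ∶∶ κ → Conj M κ Δ A →
           sdomQ Γ ≡ sdomQ Δ → Conj M κ (merge Γ Δ) (τ ∷ A)

-- Kobayashi's (qualitative) types: intersections are lists taken up to
-- the equivalence _≈_ generated by surjective reindexing (same sets).

data KTy (Q : Set) : Set where
  kbase : Q → KTy Q
  _⇒ₖ_  : List (KTy Q) → KTy Q → KTy Q

data _∶∶ₖ_ {Q : Set} : KTy Q → SType → Set where
  base∶∶ₖ : ∀ {q} → kbase q ∶∶ₖ o
  arr∶∶ₖ  : ∀ {A σ κ κ'} → All (_∶∶ₖ κ) A → σ ∶∶ₖ κ' → (A ⇒ₖ σ) ∶∶ₖ (κ ↣ κ')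

data _≈_ {Q : Set} : KTy Q → KTy Q → Set where
  base≈ : ∀ {q} → kbase q ≈ kbase q
  arr≈  : ∀ {A B σ τ} → All (λ a → Any (a ≈_) B) A → All (λ b → Any (_≈ b) A) B →
          σ ≈ τ → (A ⇒ₖ σ) ≈ (B ⇒ₖ τ)

KCtx : Set → Set
KCtx Q = List (ℕ × List (KTy Q) × SType)

sdomK : {Q : Set} → KCtx Q → SCtx
sdomK = map (λ { (x , _ , κ) → (x , κ) })

KWF : {Q : Set} → KCtx Q → Set
KWF Γ = Unique (names Γ) × All (λ { (x , A , κ) → All (_∶∶ₖ κ) A }) Γ

data _⊢ₖ_∶_∶∶_ {Q : Set} : KCtx Q → Tm → KTy Q → SType → Set where
  kax  : ∀ {Γ x A κ τ τ'} → KWF Γ → (x , A , κ) ∈ Γ → τ' ∈ A → τ ≈ τ' →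
         Γ ⊢ₖ fvar x ∶ τ ∶∶ κ
  kapp : ∀ {Γ M N A σ κ κ'} →
         Γ ⊢ₖ M ∶ (A ⇒ₖ σ) ∶∶ (κ ↣ κ') →
         All (λ τ → Γ ⊢ₖ N ∶ τ ∶∶ κ) A →
         Γ ⊢ₖ app M N ∶ σ ∶∶ κ'
  klam : ∀ {Γ x A κ M σ κ'} →
         ((x , A , κ) ∷ Γ) ⊢ₖ M ∶ σ ∶∶ κ' →
         Γ ⊢ₖ Λ x M ∶ (A ⇒ₖ σ) ∶∶ (κ ↣ κ')

mutual
  ⌊_⌋ : {Q : Set} → QTy Q → KTy Q
  ⌊ base q ⌋ = kbase q
  ⌊ A ⇒ σ ⌋  = ⌊ A ⌋* ⇒ₖ ⌊ σ ⌋

  ⌊_⌋* : {Q : Set} → List (QTy Q) → List (KTy Q)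
  ⌊ [] ⌋*    = []
  ⌊ τ ∷ A ⌋* = ⌊ τ ⌋ ∷ ⌊ A ⌋*

-- collapse of a context entry (a linear τ is the singleton intersection)
⌊_⌋ᵖ : {Q : Set} → QPre Q → List (KTy Q)
⌊ p ⌋ᵖ = ⌊ asList p ⌋*

⌊_⌋ᶜ : {Q : Set} → QCtx Q → KCtx Q
⌊ Γ ⌋ᶜ = map (λ { (x , p , κ) → (x , ⌊ p ⌋ᵖ , κ) }) Γ

_⊢ₖ_∶⌊_⌋∶∶_ : {Q : Set} → KCtx Q → Tm → QPre Q → SType → Set
Γ ⊢ₖ t ∶⌊ lin τ ⌋∶∶ κ = Γ ⊢ₖ t ∶ ⌊ τ ⌋ ∶∶ κ
Γ ⊢ₖ t ∶⌊ ⋀ A ⌋∶∶ κ   = All (λ a → Γ ⊢ₖ t ∶ ⌊ a ⌋ ∶∶ κ) A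

data _≼_ {Q : Set} : KTy Q → KTy Q → Set where
  base≼ : ∀ {q} → kbase q ≼ kbase q
  arr≼  : ∀ {A B σ τ κ κ'} →
          (A ⇒ₖ σ) ∶∶ₖ (κ ↣ κ') → (B ⇒ₖ τ) ∶∶ₖ (κ ↣ κ') →
          σ ≼ τ → All (λ a → Any (λ b → b ≼ a) B) A →
          (A ⇒ₖ σ) ≼ (B ⇒ₖ τ)

_≼∧_ : {Q : Set} → List (KTy Q) → List (KTy Q) → Set
A ≼∧ B = All (λ a → Any (λ b → b ≼ a) B) A

Approx : {Q : Set} → (ℕ × QPre Q × SType) → (ℕ × List (KTy Q) × SType) → Set
Approx (x̂ , σ̂ , κ̂) (x , σ , κ) = x̂ ≡ x × κ̂ ≡ κ × σ̂ ∶∶ᵖ κ × ⌊ σ̂ ⌋ᵖ ≼∧ σ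

-- (1) Every quantitative rule collapses to an admissible rule of Kobayashi's system: Left ⋀
-- disappears, Weakening, Exchange and Right ⋀ become weakening, Contraction becomes a renaming
-- and Left → the substitution of f N for x.  Weakening and substitution are admissible there
-- because the axiom allows unused hypotheses and intersections are sets.
--
-- (2) By induction on the long normal form.  An abstraction is lifted by Right →.  At base type
-- the term is a neutral g N₁ … Nₙ: each argument is lifted once for every component of the
-- intersection it is used at, the liftings are joined by Right ⋀ (whose context is their
-- componentwise intersection), and the spine is rebuilt around a hole x : q by one Left → per
-- argument, ending with a contraction of the hole into the head variable g.

module Submission where

open import Defs
open import Data.Empty using (⊥-elim)
open import Data.Fin using (Fin)
open import Data.Nat using (ℕ; suc; _≟_; _+_; _≤_; _<_; _⊔_)
open import Data.Nat.Properties using (≤-trans; m≤m⊔n; m≤n⊔m; m≤m+n; <-irrefl; <-≤-trans; +-cancelˡ-≡)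
open import Data.Product as Product using (Σ; ∃; _×_; _,_; proj₁; proj₂; map₁)
open import Data.Sum using (inj₁; inj₂)
open import Data.List using (List; []; _∷_; _++_; map; length)
open import Data.List.Properties using (map-++; map-∘; ++-assoc; ++-identityʳ; ∷-injectiveˡ; ∷-injectiveʳ)
open import Data.List.Membership.Propositional using (_∈_; _∉_; lose)
open import Data.List.Membership.Propositional.Properties using (∈-++⁺ˡ; ∈-++⁺ʳ; ∈-++⁻; ∈-map⁺; ∈-map⁻)
open import Data.List.Relation.Unary.All as All using (All; []; _∷_)
import Data.List.Relation.Unary.All.Properties as All
open import Data.List.Relation.Unary.Any using (Any; here; there)
open import Data.List.Relation.Unary.AllPairs as AllPairs using ([]; _∷_)
open import Data.List.Relation.Unary.Unique.Propositional using (Unique)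
open import Data.List.Relation.Unary.Unique.Propositional.Properties using (Unique[x∷xs]⇒x∉xs) renaming (++⁺ to Unique-++⁺)
open import Data.List.Relation.Binary.Pointwise as Pointwise using (Pointwise; []; _∷_)
open import Data.List.Relation.Binary.Permutation.Propositional using (_↭_; ↭-refl; ↭-sym; prep; swap; ↭⇒↭ₛ)
import Data.List.Relation.Binary.Permutation.Propositional.Properties as ↭
open import Data.List.Relation.Binary.Permutation.Setoid.Properties using (Unique-resp-↭)
open import Function using (_∘_)
open import Function.Definitions using (Injective)
open import Relation.Binary.PropositionalEquality using (_≡_; _≢_; refl; sym; trans; cong; cong₂; subst; setoid; module ≡-Reasoning)
open import Relation.Nullary using (¬_; yes; no)


msub : (ℕ → Tm) → Tm → Tm
msub s (fvar x)  = s x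
msub s (bvar i)  = bvar i
msub s (app t u) = app (msub s t) (msub s u)
msub s (lam t)   = lam (msub s t)

infixl 10 _[_≔_]
_[_≔_] : (ℕ → Tm) → ℕ → Tm → ℕ → Tm
(s [ x ≔ N ]) y with x ≟ y
... | yes _ = N
... | no  _ = s y

update-≡ : ∀ s x N → (s [ x ≔ N ]) x ≡ N
update-≡ s x N with x ≟ x
... | yes _  = refl
... | no x≢x = ⊥-elim (x≢x refl)

update-≢ : ∀ s {x y} N → x ≢ y → (s [ x ≔ N ]) y ≡ s y
update-≢ s {x} {y} N x≢y with x ≟ y
... | yes x≡y = ⊥-elim (x≢y x≡y)
... | no  _   = refl

update-cong : ∀ {s s'} x N z → s z ≡ s' z → (s [ x ≔ N ]) z ≡ (s' [ x ≔ N ]) z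
update-cong x N z sz≡s'z with x ≟ z
... | yes _ = refl
... | no  _ = sz≡s'z

update-fvar-self : ∀ x y → (fvar [ x ≔ fvar y ]) y ≡ fvar y
update-fvar-self x y with x ≟ y
... | yes _ = refl
... | no  _ = refl

substTm≡msub : ∀ x N M → substTm x N M ≡ msub (fvar [ x ≔ N ]) M
substTm≡msub x N (fvar y) with x ≟ y
... | yes _ = refl
... | no  _ = refl
substTm≡msub x N (bvar i)  = refl
substTm≡msub x N (app t u) = cong₂ app (substTm≡msub x N t) (substTm≡msub x N u)
substTm≡msub x N (lam t)   = cong lam (substTm≡msub x N t)

msub-cong : ∀ {s s'} M → (∀ z → z ∈ fv M → s z ≡ s' z) → msub s M ≡ msub s' M
msub-cong (fvar x)  eq = eq x (here refl)
msub-cong (bvar i)  eq = refl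
msub-cong (app t u) eq =
  cong₂ app (msub-cong t (λ z → eq z ∘ ∈-++⁺ˡ)) (msub-cong u (λ z → eq z ∘ ∈-++⁺ʳ (fv t)))
msub-cong (lam t)   eq = cong lam (msub-cong t eq)

msub-identity : ∀ M → msub fvar M ≡ M
msub-identity (fvar x)  = refl
msub-identity (bvar i)  = refl
msub-identity (app t u) = cong₂ app (msub-identity t) (msub-identity u)
msub-identity (lam t)   = cong lam (msub-identity t)

msub-∘ : ∀ s s' M → msub s (msub s' M) ≡ msub (msub s ∘ s') M
msub-∘ s s' (fvar x)  = refl
msub-∘ s s' (bvar i)  = refl
msub-∘ s s' (app t u) = cong₂ app (msub-∘ s s' t) (msub-∘ s s' u)
msub-∘ s s' (lam t)   = cong lam (msub-∘ s s' t)

msub-substTm : ∀ s x N M → msub s (substTm x N M) ≡ msub (s [ x ≔ msub s N ]) M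
msub-substTm s x N M = begin
  msub s (substTm x N M)               ≡⟨ cong (msub s) (substTm≡msub x N M) ⟩
  msub s (msub (fvar [ x ≔ N ]) M)     ≡⟨ msub-∘ s _ M ⟩
  msub (msub s ∘ fvar [ x ≔ N ]) M     ≡⟨ msub-cong M (λ z _ → pointwise z) ⟩
  msub (s [ x ≔ msub s N ]) M          ∎
  where
  open ≡-Reasoning
  pointwise : ∀ z → msub s ((fvar [ x ≔ N ]) z) ≡ (s [ x ≔ msub s N ]) z
  pointwise z with x ≟ z
  ... | yes _ = refl
  ... | no  _ = refl

substTm-msub : ∀ x N s M → substTm x N (msub s M) ≡ msub (substTm x N ∘ s) M
substTm-msub x N s M =
  trans (substTm≡msub x N (msub s M))
    (trans (msub-∘ _ s M) (msub-cong M (λ z _ → sym (substTm≡msub x N (s z)))))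

substTm-self : ∀ x M → substTm x (fvar x) M ≡ M
substTm-self x M =
  trans (substTm≡msub x (fvar x) M) (trans (msub-cong M (λ z _ → pointwise z)) (msub-identity M))
  where
  pointwise : ∀ z → (fvar [ x ≔ fvar x ]) z ≡ fvar z
  pointwise z with x ≟ z
  ... | yes refl = refl
  ... | no  _    = refl

substTm-app-fresh : ∀ {f x M N P} → f ∉ fv P → f ∉ fv N →
                    substTm f M (substTm x (app (fvar f) N) P) ≡ substTm x (app M N) P
substTm-app-fresh {f} {x} {M} {N} {P} f∉P f∉N = begin
  substTm f M (substTm x fN P)                ≡⟨ substTm≡msub f M (substTm x fN P) ⟩
  msub ρ (substTm x fN P)                     ≡⟨ msub-substTm ρ x fN P ⟩
  msub (ρ [ x ≔ msub ρ fN ]) P                ≡⟨ msub-cong P (λ z → update-cong x _ z ∘ ρ-fresh P f∉P) ⟩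
  msub (fvar [ x ≔ msub ρ fN ]) P             ≡⟨ cong (λ V → msub (fvar [ x ≔ V ]) P) ρfN≡MN ⟩
  msub (fvar [ x ≔ app M N ]) P               ≡⟨ substTm≡msub x (app M N) P ⟨
  substTm x (app M N) P                       ∎
  where
  open ≡-Reasoning
  fN = app (fvar f) N
  ρ = fvar [ f ≔ M ]
  ρ-fresh : ∀ T {z} → f ∉ fv T → z ∈ fv T → ρ z ≡ fvar z
  ρ-fresh T f∉T z∈ = update-≢ fvar M (λ f≡z → f∉T (subst (_∈ fv T) (sym f≡z) z∈))
  ρfN≡MN : msub ρ fN ≡ app M N
  ρfN≡MN = cong₂ app (update-≡ fvar f M) (trans (msub-cong N (λ _ → ρ-fresh N f∉N)) (msub-identity N))

fv-msub⁺ : ∀ s M {z a} → z ∈ fv M → a ∈ fv (s z) → a ∈ fv (msub s M)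
fv-msub⁺ s (fvar x)  (here refl) a∈ = a∈
fv-msub⁺ s (app t u) z∈ a∈ with ∈-++⁻ (fv t) z∈
... | inj₁ z∈t = ∈-++⁺ˡ (fv-msub⁺ s t z∈t a∈)
... | inj₂ z∈u = ∈-++⁺ʳ (fv (msub s t)) (fv-msub⁺ s u z∈u a∈)
fv-msub⁺ s (lam t)   z∈ a∈ = fv-msub⁺ s t z∈ a∈

closeAt-fresh : ∀ k x M → x ∉ fv M → closeAt k x M ≡ M
closeAt-fresh k x (fvar y) x∉ with x ≟ y
... | yes x≡y = ⊥-elim (x∉ (here x≡y))
... | no  _   = refl
closeAt-fresh k x (bvar i) x∉  = refl
closeAt-fresh k x (app t u) x∉ =
  cong₂ app (closeAt-fresh k x t (x∉ ∘ ∈-++⁺ˡ)) (closeAt-fresh k x u (x∉ ∘ ∈-++⁺ʳ (fv t)))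
closeAt-fresh k x (lam t) x∉   = cong lam (closeAt-fresh (suc k) x t x∉)

fv-closeAt : ∀ k x M {z} → z ∈ fv (closeAt k x M) → z ∈ fv M × z ≢ x
fv-closeAt k x (fvar y) z∈ with x ≟ y
fv-closeAt k x (fvar y) ()          | yes _
fv-closeAt k x (fvar y) (here refl) | no x≢y = here refl , x≢y ∘ sym
fv-closeAt k x (app t u) z∈ with ∈-++⁻ (fv (closeAt k x t)) z∈
... | inj₁ z∈t = let (z∈ , z≢x) = fv-closeAt k x t z∈t in ∈-++⁺ˡ z∈ , z≢x
... | inj₂ z∈u = let (z∈ , z≢x) = fv-closeAt k x u z∈u in ∈-++⁺ʳ (fv t) z∈ , z≢x
fv-closeAt k x (lam t) z∈ = fv-closeAt (suc k) x t z∈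

msub-closeAt : ∀ {s x x'} k M → s x ≡ fvar x' →
               (∀ y → y ∈ fv M → y ≢ x → x' ∉ fv (s y)) →
               msub s (closeAt k x M) ≡ closeAt k x' (msub s M)
msub-closeAt {s} {x} {x'} k (fvar y) sx≡x' fresh with x ≟ y
... | yes refl = trans (sym (closeAt-self x')) (cong (closeAt k x') (sym sx≡x'))
  where
  closeAt-self : ∀ z → closeAt k z (fvar z) ≡ bvar k
  closeAt-self z with z ≟ z
  ... | yes _  = refl
  ... | no z≢z = ⊥-elim (z≢z refl)
... | no x≢y = sym (closeAt-fresh k x' (s y) (fresh y (here refl) (x≢y ∘ sym)))
msub-closeAt k (bvar i)  _ _ = refl
msub-closeAt k (app t u) sx≡x' fresh =
  cong₂ app (msub-closeAt k t sx≡x' (λ y → fresh y ∘ ∈-++⁺ˡ))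
            (msub-closeAt k u sx≡x' (λ y → fresh y ∘ ∈-++⁺ʳ (fv t)))
msub-closeAt k (lam t)   sx≡x' fresh = cong lam (msub-closeAt (suc k) t sx≡x' fresh)

msub-Λ : ∀ s x x' M → x' ∉ fv (msub s M) → msub s (Λ x M) ≡ Λ x' (msub (s [ x ≔ fvar x' ]) M)
msub-Λ s x x' M x'∉ = cong lam (trans
  (msub-cong (closeAt 0 x M) (λ z z∈ → sym (update-≢ s _ (λ x≡z → proj₂ (fv-closeAt 0 x M z∈) (sym x≡z)))))
  (msub-closeAt 0 M (update-≡ s x _)
     (λ y y∈ y≢x x'∈ → x'∉ (fv-msub⁺ s M y∈ (subst (λ T → x' ∈ fv T) (update-≢ s _ (y≢x ∘ sym)) x'∈)))))

strictUpperBound : (xs : List ℕ) → ∃ λ c → All (_< c) xs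
strictUpperBound []       = 0 , []
strictUpperBound (x ∷ xs) with strictUpperBound xs
... | c , xs<c = suc x ⊔ c , m≤m⊔n (suc x) c ∷ All.map (λ y<c → ≤-trans y<c (m≤n⊔m (suc x) c)) xs<c

fresh : (xs : List ℕ) → ∃ (_∉ xs)
fresh xs with strictUpperBound xs
... | c , xs<c = c , λ c∈ → <-irrefl refl (All.lookup xs<c c∈)

-- Weakening and substitution in Kobayashi's system

Unique-∷ : ∀ {x : ℕ} {xs} → x ∉ xs → Unique xs → Unique (x ∷ xs)
Unique-∷ x∉ u = All.¬Any⇒All¬ _ x∉ ∷ u

names-∈ : ∀ {A : Set} {K : List (ℕ × A)} {x a} → (x , a) ∈ K → x ∈ names K
names-∈ = ∈-map⁺ proj₁

head-≢ : ∀ {A : Set} {K : List (ℕ × A)} {y x b} → Unique (y ∷ names K) → (x , b) ∈ K → y ≢ x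
head-≢ u x∈ refl = Unique[x∷xs]⇒x∉xs u (names-∈ x∈)

lookup-functional : ∀ {A : Set} {K : List (ℕ × A)} {x a b} → Unique (names K) → (x , a) ∈ K → (x , b) ∈ K → a ≡ b
lookup-functional u        (here refl) (here refl) = refl
lookup-functional u        (here refl) (there x∈)  = ⊥-elim (Unique[x∷xs]⇒x∉xs u (names-∈ x∈))
lookup-functional u        (there x∈)  (here refl) = ⊥-elim (Unique[x∷xs]⇒x∉xs u (names-∈ x∈))
lookup-functional (_ ∷ u) (there x∈)  (there x∈') = lookup-functional u x∈ x∈'

module _ {Q : Set} where

  ⊢ₖ-≡ : ∀ {K : KCtx Q} {M M' τ κ} → M ≡ M' → K ⊢ₖ M ∶ τ ∶∶ κ → K ⊢ₖ M' ∶ τ ∶∶ κ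
  ⊢ₖ-≡ refl d = d

  ⊢ₖ-wf : ∀ {K : KCtx Q} {t τ κ} → K ⊢ₖ t ∶ τ ∶∶ κ → KWF K
  ⊢ₖ-wf (kax wf _ _ _) = wf
  ⊢ₖ-wf (kapp d _)     = ⊢ₖ-wf d
  ⊢ₖ-wf (klam d) with ⊢ₖ-wf d
  ... | _ ∷ u , _ ∷ refines = u , refines

  KWF-∷ : ∀ {K : KCtx Q} {y A κ} → KWF K → y ∉ names K → All (_∶∶ₖ κ) A → KWF ((y , A , κ) ∷ K)
  KWF-∷ (u , refines) y∉ A∶∶κ = Unique-∷ y∉ u , A∶∶κ ∷ refines

  mutual
    ≈-refl : (τ : KTy Q) → τ ≈ τ
    ≈-refl (kbase q) = base≈
    ≈-refl (A ⇒ₖ σ)  = arr≈ (⊆-by-≈ A) (⊇-by-≈ A) (≈-refl σ)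

    ⊆-by-≈ : (A : List (KTy Q)) → All (λ a → Any (a ≈_) A) A
    ⊆-by-≈ []      = []
    ⊆-by-≈ (a ∷ A) = here (≈-refl a) ∷ All.map there (⊆-by-≈ A)

    ⊇-by-≈ : (A : List (KTy Q)) → All (λ a → Any (_≈ a) A) A
    ⊇-by-≈ []      = []
    ⊇-by-≈ (a ∷ A) = here (≈-refl a) ∷ All.map there (⊇-by-≈ A)

  infix 4 _⊆ₖ_
  _⊆ₖ_ : KCtx Q → KCtx Q → Set
  K ⊆ₖ K' = ∀ {x A κ a} → (x , A , κ) ∈ K → a ∈ A → ∃ λ B → (x , B , κ) ∈ K' × a ∈ B

  ⊆⇒⊆ₖ : ∀ {K K' : KCtx Q} → (∀ {e} → e ∈ K → e ∈ K') → K ⊆ₖ K'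
  ⊆⇒⊆ₖ K⊆K' x∈ a∈ = _ , K⊆K' x∈ , a∈

  ⊆ₖ-trans : ∀ {K K' K'' : KCtx Q} → K ⊆ₖ K' → K' ⊆ₖ K'' → K ⊆ₖ K''
  ⊆ₖ-trans K⊆K' K'⊆K'' x∈ a∈ with K⊆K' x∈ a∈
  ... | _ , x∈' , a∈' = K'⊆K'' x∈' a∈'

  -- Quantifying over all extensions K'' of K' makes the hypothesis stable under binders.
  Substitution : (ℕ → Tm) → KCtx Q → KCtx Q → Set
  Substitution s K K' = ∀ {K''} → KWF K'' → K' ⊆ₖ K'' →
    ∀ {x A κ τ τ'} → (x , A , κ) ∈ K → τ' ∈ A → τ ≈ τ' → K'' ⊢ₖ s x ∶ τ ∶∶ κ

  mutual
    ⊢ₖ-subst : ∀ {K K' : KCtx Q} {M α κ} {s} → K ⊢ₖ M ∶ α ∶∶ κ → KWF K' → Substitution s K K' →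
               K' ⊢ₖ msub s M ∶ α ∶∶ κ
    ⊢ₖ-subst (kax _ x∈ τ'∈ τ≈τ') wf σ = σ wf (λ x∈' a∈ → _ , x∈' , a∈) x∈ τ'∈ τ≈τ'
    ⊢ₖ-subst (kapp d ds) wf σ = kapp (⊢ₖ-subst d wf σ) (⊢ₖ-subst* ds wf σ)
    ⊢ₖ-subst {K} {K'} {s = s} (klam {x = y} {A = A} {κ = κ} {M = M} d) wf σ =
      ⊢ₖ-≡ (sym (msub-Λ s y y' M y'∉M)) (klam (⊢ₖ-subst d wf' σ'))
      where
      y' = proj₁ (fresh (names K' ++ fv (msub s M)))
      y'∉ = proj₂ (fresh (names K' ++ fv (msub s M)))
      y'∉M : y' ∉ fv (msub s M)
      y'∉M = y'∉ ∘ ∈-++⁺ʳ (names K')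
      wf-d = ⊢ₖ-wf d
      wf' : KWF ((y' , A , κ) ∷ K')
      wf' = KWF-∷ wf (y'∉ ∘ ∈-++⁺ˡ) (All.head (proj₂ wf-d))
      σ' : Substitution (s [ y ≔ fvar y' ]) ((y , A , κ) ∷ K) ((y' , A , κ) ∷ K')
      σ' wf'' ext (here refl) τ'∈ τ≈τ' with ext (here refl) τ'∈
      ... | _ , y'∈ , τ'∈' = ⊢ₖ-≡ (sym (update-≡ s y _)) (kax wf'' y'∈ τ'∈' τ≈τ')
      σ' wf'' ext (there x∈) τ'∈ τ≈τ' =
        ⊢ₖ-≡ (sym (update-≢ s (fvar y') (head-≢ (proj₁ wf-d) x∈))) (σ wf'' (ext ∘ there) x∈ τ'∈ τ≈τ')

    ⊢ₖ-subst* : ∀ {K K' : KCtx Q} {N A κ} {s} → All (λ τ → K ⊢ₖ N ∶ τ ∶∶ κ) A → KWF K' →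
                Substitution s K K' → All (λ τ → K' ⊢ₖ msub s N ∶ τ ∶∶ κ) A
    ⊢ₖ-subst* []       wf σ = []
    ⊢ₖ-subst* (d ∷ ds) wf σ = ⊢ₖ-subst d wf σ ∷ ⊢ₖ-subst* ds wf σ

  ⊢ₖ-weaken : ∀ {K K' : KCtx Q} {M α κ} → K ⊢ₖ M ∶ α ∶∶ κ → KWF K' → K ⊆ₖ K' → K' ⊢ₖ M ∶ α ∶∶ κ
  ⊢ₖ-weaken {M = M} d wf K⊆K' = ⊢ₖ-≡ (msub-identity M) (⊢ₖ-subst d wf byVariables)
    where
    byVariables : Substitution fvar _ _
    byVariables wf'' ext x∈ τ'∈ τ≈τ' with ⊆ₖ-trans K⊆K' ext x∈ τ'∈
    ... | _ , x∈' , τ'∈' = kax wf'' x∈' τ'∈' τ≈τ'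

-- (1) Collapse of quantitative derivations

module _ {Q : Set} where

  Refines : ℕ × QPre Q × SType → Set
  Refines (_ , p , κ) = p ∶∶ᵖ κ

  WellFormed : QCtx Q → Set
  WellFormed Γ = Unique (names Γ) × All Refines Γ

  asList-∶∶ : ∀ {p : QPre Q} {κ} → p ∶∶ᵖ κ → All (_∶∶ κ) (asList p)
  asList-∶∶ {lin τ} τ∶∶κ = τ∶∶κ ∷ []
  asList-∶∶ {⋀ A}   A∶∶κ = A∶∶κ

  names-toInt : ∀ (Γ : QCtx Q) → names (toInt Γ) ≡ names Γ
  names-toInt Γ = sym (map-∘ Γ)

  toInt-refines : ∀ {Γ : QCtx Q} → All Refines Γ → All Refines (toInt Γ)
  toInt-refines {[]}                []       = []
  toInt-refines {(_ , p , _) ∷ Γ} (r ∷ rs) = asList-∶∶ {p} r ∷ toInt-refines rs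

  names-merge : ∀ (Γ Δ : QCtx Q) → sdomQ Γ ≡ sdomQ Δ → names (merge Γ Δ) ≡ names Γ
  names-merge []              Δ       _  = refl
  names-merge ((x , _) ∷ Γ) (_ ∷ Δ) eq = cong (x ∷_) (names-merge Γ Δ (∷-injectiveʳ eq))

  merge-refines : ∀ (Γ Δ : QCtx Q) → sdomQ Γ ≡ sdomQ Δ → All Refines Γ → All Refines Δ → All Refines (merge Γ Δ)
  merge-refines []                  Δ                     _  _        _          = []
  merge-refines ((_ , p , _) ∷ Γ) ((_ , p' , _) ∷ Δ) eq (r ∷ rs) (r' ∷ rs') with ∷-injectiveˡ eq
  ... | refl = All.++⁺ (asList-∶∶ {p} r) (asList-∶∶ {p'} r') ∷ merge-refines Γ Δ (∷-injectiveʳ eq) rs rs'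

  names-++ : ∀ (Γ Δ : QCtx Q) → names (Γ ++ Δ) ≡ names Γ ++ names Δ
  names-++ = map-++ proj₁

  mutual
    ⊢-wf : ∀ {Γ M σ κ} → Γ ⊢ M ∶ σ ∶∶ κ → WellFormed Γ × σ ∶∶ᵖ κ
    ⊢-wf ax = (Unique-∷ (λ ()) [] , base∶∶ ∷ []) , base∶∶
    ⊢-wf (left∧ d) with ⊢-wf d
    ... | (u , r ∷ rs) , σ∶∶κ = (u , (r ∷ []) ∷ rs) , σ∶∶κ
    ⊢-wf (right∧ c) = Conj-wf c
    ⊢-wf right∧∅ = ([] , []) , []
    ⊢-wf (left→ {Γ₁} {Γ₂} d₁ d₂ disj f∉Γ₁ f∉Γ₂) with ⊢-wf d₁ | ⊢-wf d₂
    ... | (u₁ , rs₁) , A∶∶κ | (_ ∷ u₂ , r ∷ rs₂) , α∶∶κ'' =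
      (subst Unique (sym (trans (names-++ Γ₁ _) (cong (names Γ₁ ++_) (names-++ Γ₂ _))))
         (Unique-++⁺ u₁ (Unique-++⁺ u₂ (Unique-∷ (λ ()) []) Γ₂#f) Γ₁#Γ₂f) ,
       All.++⁺ rs₁ (All.++⁺ rs₂ (arr∶∶ A∶∶κ r ∷ []))) , α∶∶κ''
      where
      Γ₂#f : ∀ {v} → ¬ (v ∈ names Γ₂ × v ∈ _ ∷ [])
      Γ₂#f (v∈ , here refl) = f∉Γ₂ v∈
      Γ₁#Γ₂f : ∀ {v} → ¬ (v ∈ names Γ₁ × v ∈ names Γ₂ ++ _ ∷ [])
      Γ₁#Γ₂f (v∈₁ , v∈) with ∈-++⁻ (names Γ₂) v∈
      ... | inj₁ v∈₂         = All.lookup disj v∈₁ v∈₂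
      ... | inj₂ (here refl) = f∉Γ₁ v∈₁
    ⊢-wf (right→ d) with ⊢-wf d
    ... | (_ ∷ u , r ∷ rs) , σ∶∶κ' = (u , rs) , arr∶∶ r σ∶∶κ'
    ⊢-wf (weak x∉ d) with ⊢-wf d
    ... | (u , rs) , σ∶∶κ' = (Unique-∷ x∉ u , [] ∷ rs) , σ∶∶κ'
    ⊢-wf (contr x∉ d) with ⊢-wf d
    ... | (_ ∷ _ ∷ u , r₁ ∷ r₂ ∷ rs) , σ∶∶κ' = (Unique-∷ x∉ u , All.++⁺ r₁ r₂ ∷ rs) , σ∶∶κ'
    ⊢-wf (exch d Γ↭Γ') with ⊢-wf d
    ... | (u , rs) , σ∶∶κ' =
      (Unique-resp-↭ (setoid ℕ) (↭⇒↭ₛ (↭.map⁺ proj₁ Γ↭Γ')) u , ↭.All-resp-↭ Γ↭Γ' rs) , σ∶∶κ'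

    Conj-wf : ∀ {M κ Γ A} → Conj M κ Γ A → WellFormed Γ × All (_∶∶ κ) A
    Conj-wf (one {Γ} d) with ⊢-wf d
    ... | (u , rs) , τ∶∶κ = (subst Unique (sym (names-toInt Γ)) u , toInt-refines rs) , τ∶∶κ ∷ []
    Conj-wf (more {Γ} {Δ} d c eq) with ⊢-wf d | Conj-wf c
    ... | (u , rs) , τ∶∶κ | (_ , rs') , A∶∶κ =
      (subst Unique (sym (names-merge Γ Δ eq)) u , merge-refines Γ Δ eq rs rs') , τ∶∶κ ∷ A∶∶κ

  mutual
    ⌊⌋-∶∶ : ∀ {τ : QTy Q} {κ} → τ ∶∶ κ → ⌊ τ ⌋ ∶∶ₖ κ
    ⌊⌋-∶∶ base∶∶              = base∶∶ₖ
    ⌊⌋-∶∶ (arr∶∶ A∶∶κ σ∶∶κ') = arr∶∶ₖ (⌊⌋*-∶∶ A∶∶κ) (⌊⌋-∶∶ σ∶∶κ')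

    ⌊⌋*-∶∶ : ∀ {A : List (QTy Q)} {κ} → All (_∶∶ κ) A → All (_∶∶ₖ κ) ⌊ A ⌋*
    ⌊⌋*-∶∶ []       = []
    ⌊⌋*-∶∶ (r ∷ rs) = ⌊⌋-∶∶ r ∷ ⌊⌋*-∶∶ rs

  All-⌊⌋* : ∀ {P : KTy Q → Set} {A : List (QTy Q)} → All (P ∘ ⌊_⌋) A → All P ⌊ A ⌋*
  All-⌊⌋* []       = []
  All-⌊⌋* (p ∷ ps) = p ∷ All-⌊⌋* ps

  ⌊⌋*-++ : ∀ (A B : List (QTy Q)) → ⌊ A ++ B ⌋* ≡ ⌊ A ⌋* ++ ⌊ B ⌋*
  ⌊⌋*-++ []      B = refl
  ⌊⌋*-++ (a ∷ A) B = cong (⌊ a ⌋ ∷_) (⌊⌋*-++ A B)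

  ∈-⌊⌋*-++⁺ˡ : ∀ {a} {A B : List (QTy Q)} → a ∈ ⌊ A ⌋* → a ∈ ⌊ A ++ B ⌋*
  ∈-⌊⌋*-++⁺ˡ {A = A} {B} = subst (_ ∈_) (sym (⌊⌋*-++ A B)) ∘ ∈-++⁺ˡ

  ∈-⌊⌋*-++⁺ʳ : ∀ {b} {A B : List (QTy Q)} → b ∈ ⌊ B ⌋* → b ∈ ⌊ A ++ B ⌋*
  ∈-⌊⌋*-++⁺ʳ {A = A} {B} = subst (_ ∈_) (sym (⌊⌋*-++ A B)) ∘ ∈-++⁺ʳ ⌊ A ⌋*

  ⌊⌋ᶜ-++ : ∀ (Γ Δ : QCtx Q) → ⌊ Γ ++ Δ ⌋ᶜ ≡ ⌊ Γ ⌋ᶜ ++ ⌊ Δ ⌋ᶜ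
  ⌊⌋ᶜ-++ = map-++ _

  names-⌊⌋ᶜ : ∀ (Γ : QCtx Q) → names ⌊ Γ ⌋ᶜ ≡ names Γ
  names-⌊⌋ᶜ Γ = sym (map-∘ Γ)

  ⌊⌋ᶜ-wf : ∀ {Γ : QCtx Q} → WellFormed Γ → KWF ⌊ Γ ⌋ᶜ
  ⌊⌋ᶜ-wf {Γ} (u , rs) = subst Unique (sym (names-⌊⌋ᶜ Γ)) u , refines rs
    where
    refines : ∀ {Γ} → All Refines Γ → All (λ { (_ , A , κ) → All (_∶∶ₖ κ) A }) ⌊ Γ ⌋ᶜ
    refines {[]}                []       = []
    refines {(_ , p , _) ∷ Γ} (r ∷ rs) = ⌊⌋*-∶∶ (asList-∶∶ {p} r) ∷ refines rs

  ⊢-⌊wf⌋ : ∀ {Γ M σ κ} → Γ ⊢ M ∶ σ ∶∶ κ → KWF ⌊ Γ ⌋ᶜ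
  ⊢-⌊wf⌋ = ⌊⌋ᶜ-wf ∘ proj₁ ∘ ⊢-wf

  ⌊toInt⌋ᶜ : ∀ (Γ : QCtx Q) → ⌊ toInt Γ ⌋ᶜ ≡ ⌊ Γ ⌋ᶜ
  ⌊toInt⌋ᶜ Γ = sym (map-∘ Γ)

  ⌊⌋ᶜ-⊆-merge : ∀ (Γ Δ : QCtx Q) → sdomQ Γ ≡ sdomQ Δ →
                ⌊ Γ ⌋ᶜ ⊆ₖ ⌊ merge Γ Δ ⌋ᶜ × ⌊ Δ ⌋ᶜ ⊆ₖ ⌊ merge Γ Δ ⌋ᶜ
  ⌊⌋ᶜ-⊆-merge [] [] _ = (λ ()) , (λ ())
  ⌊⌋ᶜ-⊆-merge ((x , p , κ) ∷ Γ) ((_ , p' , _) ∷ Δ) eq with ∷-injectiveˡ eq | ⌊⌋ᶜ-⊆-merge Γ Δ (∷-injectiveʳ eq)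
  ... | refl | Γ⊆ , Δ⊆ = left , right
    where
    left : _ ⊆ₖ _
    left (here refl) a∈ = _ , here refl , ∈-⌊⌋*-++⁺ˡ {A = asList p} a∈
    left (there y∈)  a∈ = let (B , y∈' , a∈') = Γ⊆ y∈ a∈ in B , there y∈' , a∈'
    right : _ ⊆ₖ _
    right (here refl) a∈ = _ , here refl , ∈-⌊⌋*-++⁺ʳ {A = asList p} a∈
    right (there y∈)  a∈ = let (B , y∈' , a∈') = Δ⊆ y∈ a∈ in B , there y∈' , a∈'

  ∶⌊⌋-map : ∀ {K K' : KCtx Q} {M M' κ} (σ : QPre Q) →
            (∀ {τ} → K ⊢ₖ M ∶ τ ∶∶ κ → K' ⊢ₖ M' ∶ τ ∶∶ κ) →
            K ⊢ₖ M ∶⌊ σ ⌋∶∶ κ → K' ⊢ₖ M' ∶⌊ σ ⌋∶∶ κ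
  ∶⌊⌋-map (lin τ) f d  = f d
  ∶⌊⌋-map (⋀ A)   f ds = All.map f ds

  mutual
    collapse : ∀ {Γ M σ κ} → Γ ⊢ M ∶ σ ∶∶ κ → ⌊ Γ ⌋ᶜ ⊢ₖ M ∶⌊ σ ⌋∶∶ κ
    collapse d@ax = kax (⊢-⌊wf⌋ d) (here refl) (here refl) base≈
    collapse (left∧ d)  = collapse d
    collapse (right∧ c) = collapse-Conj c
    collapse right∧∅    = []
    collapse d@(left→ {Γ₁} {Γ₂} {N} {A} {κ} {x} {σ} {κ'} {M} {α} {κ''} {f} d₁ d₂ _ _ _) =
      ∶⌊⌋-map α (λ d' → ⊢ₖ-≡ (sym (substTm≡msub x (app (fvar f) N) M)) (⊢ₖ-subst d' (⊢-⌊wf⌋ d) x↦fN))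
        (collapse d₂)
      where
      fEntry = (f , ⌊ A ⇒ σ ⌋ ∷ [] , κ ↣ κ')
      K' = ⌊ Γ₁ ++ Γ₂ ++ (f , lin (A ⇒ σ) , κ ↣ κ') ∷ [] ⌋ᶜ
      into : ∀ {e} → e ∈ ⌊ Γ₁ ⌋ᶜ ++ ⌊ Γ₂ ⌋ᶜ ++ fEntry ∷ [] → e ∈ K'
      into = subst (_ ∈_) (sym (trans (⌊⌋ᶜ-++ Γ₁ _) (cong (⌊ Γ₁ ⌋ᶜ ++_) (⌊⌋ᶜ-++ Γ₂ _))))
      f∈K' : fEntry ∈ K'
      f∈K' = into (∈-++⁺ʳ ⌊ Γ₁ ⌋ᶜ (∈-++⁺ʳ ⌊ Γ₂ ⌋ᶜ (here refl)))
      Γ₁⊆K' : ⌊ Γ₁ ⌋ᶜ ⊆ₖ K'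
      Γ₁⊆K' = ⊆⇒⊆ₖ (into ∘ ∈-++⁺ˡ)
      x∉Γ₂ = proj₁ (⊢-⌊wf⌋ d₂)
      x↦fN : Substitution (fvar [ x ≔ app (fvar f) N ]) ((x , ⌊ σ ⌋ ∷ [] , κ') ∷ ⌊ Γ₂ ⌋ᶜ) K'
      x↦fN wf ext (here refl) (here refl) τ≈⌊σ⌋ with ext f∈K' (here refl)
      ... | _ , f∈ , ⌊A⇒σ⌋∈ =
        ⊢ₖ-≡ (sym (update-≡ fvar x _))
          (kapp (kax wf f∈ ⌊A⇒σ⌋∈ (arr≈ (⊆-by-≈ _) (⊇-by-≈ _) τ≈⌊σ⌋))
                (All.map (λ dN → ⊢ₖ-weaken dN wf (⊆ₖ-trans Γ₁⊆K' ext)) (All-⌊⌋* (collapse d₁))))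
      x↦fN wf ext (there z∈) τ'∈ τ≈τ' with ext (into (∈-++⁺ʳ ⌊ Γ₁ ⌋ᶜ (∈-++⁺ˡ z∈))) τ'∈
      ... | _ , z∈' , τ'∈' = ⊢ₖ-≡ (sym (update-≢ fvar (app (fvar f) N) (head-≢ x∉Γ₂ z∈))) (kax wf z∈' τ'∈' τ≈τ')
    collapse (right→ d) = klam (collapse d)
    collapse d@(weak {σ = σ} _ d') =
      ∶⌊⌋-map σ (λ d'' → ⊢ₖ-weaken d'' (⊢-⌊wf⌋ d) (⊆⇒⊆ₖ there)) (collapse d')
    collapse d@(contr {Γ} {x} {y} {z} {A} {B} {κ} {M} {σ} _ d') =
      ∶⌊⌋-map σ (λ d'' → ⊢ₖ-≡ (sym substTm²≡msub) (⊢ₖ-subst d'' (⊢-⌊wf⌋ d) y,z↦x)) (collapse d')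
      where
      ρ = fvar [ y ≔ fvar x ]
      substTm²≡msub : substTm y (fvar x) (substTm z (fvar x) M) ≡ msub (ρ [ z ≔ ρ x ]) M
      substTm²≡msub = trans (substTm≡msub y (fvar x) (substTm z (fvar x) M)) (msub-substTm ρ z (fvar x) M)
      y,z,Γ-distinct = proj₁ (⊢-⌊wf⌋ d')
      y≢ : ∀ {w b} → (w , b) ∈ (z , ⌊ B ⌋* , κ) ∷ ⌊ Γ ⌋ᶜ → y ≢ w
      y≢ = head-≢ y,z,Γ-distinct
      z≢ : ∀ {w b} → (w , b) ∈ ⌊ Γ ⌋ᶜ → z ≢ w
      z≢ = head-≢ (AllPairs.tail y,z,Γ-distinct)
      x-typed : ∀ {K'' τ τ'} → KWF K'' → (x , ⌊ A ++ B ⌋* , κ) ∷ ⌊ Γ ⌋ᶜ ⊆ₖ K'' →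
                τ' ∈ ⌊ A ++ B ⌋* → τ ≈ τ' → K'' ⊢ₖ fvar x ∶ τ ∶∶ κ
      x-typed wf ext τ'∈ τ≈τ' with ext (here refl) τ'∈
      ... | _ , x∈ , τ'∈' = kax wf x∈ τ'∈' τ≈τ'
      y,z↦x : Substitution (ρ [ z ≔ ρ x ])
                ((y , ⌊ A ⌋* , κ) ∷ (z , ⌊ B ⌋* , κ) ∷ ⌊ Γ ⌋ᶜ) ((x , ⌊ A ++ B ⌋* , κ) ∷ ⌊ Γ ⌋ᶜ)
      y,z↦x wf ext (here refl) τ'∈ τ≈τ' =
        ⊢ₖ-≡ (sym (trans (update-≢ ρ (ρ x) (y≢ (here refl) ∘ sym)) (update-≡ fvar y (fvar x))))
          (x-typed wf ext (∈-⌊⌋*-++⁺ˡ {A = A} τ'∈) τ≈τ')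
      y,z↦x wf ext (there (here refl)) τ'∈ τ≈τ' =
        ⊢ₖ-≡ (sym (trans (update-≡ ρ z (ρ x)) (update-fvar-self y x)))
          (x-typed wf ext (∈-⌊⌋*-++⁺ʳ {A = A} τ'∈) τ≈τ')
      y,z↦x wf ext (there (there w∈)) τ'∈ τ≈τ' with ext (there w∈) τ'∈
      ... | _ , w∈' , τ'∈' =
        ⊢ₖ-≡ (sym (trans (update-≢ ρ (ρ x) (z≢ w∈)) (update-≢ fvar (fvar x) (y≢ (there w∈)))))
          (kax wf w∈' τ'∈' τ≈τ')
    collapse d@(exch {σ = σ} d' Γ↭Γ') =
      ∶⌊⌋-map σ (λ d'' → ⊢ₖ-weaken d'' (⊢-⌊wf⌋ d) (⊆⇒⊆ₖ (↭.∈-resp-↭ (↭.map⁺ _ Γ↭Γ')))) (collapse d')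

    collapse-Conj : ∀ {M κ Γ A} → Conj M κ Γ A → All (λ a → ⌊ Γ ⌋ᶜ ⊢ₖ M ∶ ⌊ a ⌋ ∶∶ κ) A
    collapse-Conj (one {Γ} d) = subst (λ K → K ⊢ₖ _ ∶ _ ∶∶ _) (sym (⌊toInt⌋ᶜ Γ)) (collapse d) ∷ []
    collapse-Conj c@(more {Γ} {Δ} d c' eq) =
      ⊢ₖ-weaken (collapse d) wf Γ⊆ ∷ All.map (λ d' → ⊢ₖ-weaken d' wf Δ⊆) (collapse-Conj c')
      where
      wf = ⌊⌋ᶜ-wf (proj₁ (Conj-wf c))
      Γ⊆ = proj₁ (⌊⌋ᶜ-⊆-merge Γ Δ eq)
      Δ⊆ = proj₂ (⌊⌋ᶜ-⊆-merge Γ Δ eq)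

-- Name-free long normal forms

infix 4 _∋ᵇ_∶_
data _∋ᵇ_∶_ : List SType → ℕ → SType → Set where
  bz : ∀ {κ Ψ} → (κ ∷ Ψ) ∋ᵇ 0 ∶ κ
  bs : ∀ {κ κ' Ψ i} → Ψ ∋ᵇ i ∶ κ → (κ' ∷ Ψ) ∋ᵇ suc i ∶ κ

-- Bound variables are typed by the de Bruijn context Ψ, so that, unlike LNF, these do not
-- depend on the names chosen for the binders, which differ from those chosen by klam.
mutual
  data Ne (Δ : SCtx) (Ψ : List SType) : Tm → SType → Set where
    ne-var  : ∀ {x κ} → (x , κ) ∈ Δ → Ne Δ Ψ (fvar x) κ
    ne-bvar : ∀ {i κ} → Ψ ∋ᵇ i ∶ κ → Ne Δ Ψ (bvar i) κ
    ne-app  : ∀ {t u κ κ'} → Ne Δ Ψ t (κ ↣ κ') → Nf Δ Ψ u κ → Ne Δ Ψ (app t u) κ'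

  data Nf (Δ : SCtx) (Ψ : List SType) : Tm → SType → Set where
    nf-ne  : ∀ {t} → Ne Δ Ψ t o → Nf Δ Ψ t o
    nf-lam : ∀ {t κ κ'} → Nf Δ (κ ∷ Ψ) t κ' → Nf Δ Ψ (lam t) (κ ↣ κ')

∋ᵇ-functional : ∀ {Ψ i κ κ'} → Ψ ∋ᵇ i ∶ κ → Ψ ∋ᵇ i ∶ κ' → κ ≡ κ'
∋ᵇ-functional bz     bz     = refl
∋ᵇ-functional (bs p) (bs q) = ∋ᵇ-functional p q

∋ᵇ-++⁺ˡ : ∀ {Ψ i κ} Ψ' → Ψ ∋ᵇ i ∶ κ → (Ψ ++ Ψ') ∋ᵇ i ∶ κ
∋ᵇ-++⁺ˡ Ψ' bz     = bz
∋ᵇ-++⁺ˡ Ψ' (bs p) = bs (∋ᵇ-++⁺ˡ Ψ' p)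

∋ᵇ-last : ∀ Ψ {κ} → (Ψ ++ κ ∷ []) ∋ᵇ length Ψ ∶ κ
∋ᵇ-last []      = bz
∋ᵇ-last (_ ∷ Ψ) = bs (∋ᵇ-last Ψ)

mutual
  Ne-unopen : ∀ {Δ Ψ x κx κ} t → Ne ((x , κx) ∷ Δ) Ψ (openAt (length Ψ) (fvar x) t) κ →
              x ∉ fv t → x ∉ names Δ → Ne Δ (Ψ ++ κx ∷ []) t κ
  Ne-unopen (fvar y) (ne-var (here refl)) x∉t _ = ⊥-elim (x∉t (here refl))
  Ne-unopen (fvar y) (ne-var (there y∈))  _   _ = ne-var y∈
  Ne-unopen {Ψ = Ψ} (bvar i) n _ x∉Δ with i ≟ length Ψ
  Ne-unopen {Ψ = Ψ} (bvar i) (ne-var (here refl)) _ _   | yes refl = ne-bvar (∋ᵇ-last Ψ)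
  Ne-unopen {Ψ = Ψ} (bvar i) (ne-var (there x∈))  _ x∉Δ | yes refl = ⊥-elim (x∉Δ (names-∈ x∈))
  Ne-unopen {Ψ = Ψ} (bvar i) (ne-bvar p)          _ _   | no  _    = ne-bvar (∋ᵇ-++⁺ˡ _ p)
  Ne-unopen (app t u) (ne-app n m) x∉t x∉Δ =
    ne-app (Ne-unopen t n (x∉t ∘ ∈-++⁺ˡ) x∉Δ) (Nf-unopen u m (x∉t ∘ ∈-++⁺ʳ (fv t)) x∉Δ)

  Nf-unopen : ∀ {Δ Ψ x κx κ} t → Nf ((x , κx) ∷ Δ) Ψ (openAt (length Ψ) (fvar x) t) κ →
              x ∉ fv t → x ∉ names Δ → Nf Δ (Ψ ++ κx ∷ []) t κ
  Nf-unopen (fvar y)  (nf-ne n) x∉t x∉Δ = nf-ne (Ne-unopen (fvar y) n x∉t x∉Δ)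
  Nf-unopen {Ψ = Ψ} (bvar i) m x∉t x∉Δ with i ≟ length Ψ
  Nf-unopen {Ψ = Ψ} (bvar i) (nf-ne (ne-var (here refl))) _ _   | yes refl = nf-ne (ne-bvar (∋ᵇ-last Ψ))
  Nf-unopen {Ψ = Ψ} (bvar i) (nf-ne (ne-var (there x∈))) _ x∉Δ | yes refl = ⊥-elim (x∉Δ (names-∈ x∈))
  Nf-unopen {Ψ = Ψ} (bvar i) (nf-ne (ne-bvar p))         _ _   | no  _    = nf-ne (ne-bvar (∋ᵇ-++⁺ˡ _ p))
  Nf-unopen (app t u) (nf-ne n) x∉t x∉Δ = nf-ne (Ne-unopen (app t u) n x∉t x∉Δ)
  Nf-unopen (lam t)   (nf-lam m) x∉t x∉Δ = nf-lam (Nf-unopen t m x∉t x∉Δ)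

mutual
  LNF⇒Nf : ∀ {Δ t κ} → LNF Δ t κ → Nf Δ [] t κ
  LNF⇒Nf (lnf-o n) = nf-ne (Neutral⇒Ne n)
  LNF⇒Nf {t = lam t} (lnf-lam x x∉Δ x∉t m) = nf-lam (Nf-unopen {Ψ = []} t (LNF⇒Nf m) x∉t x∉Δ)

  Neutral⇒Ne : ∀ {Δ t κ} → Neutral Δ t κ → Ne Δ [] t κ
  Neutral⇒Ne (nvar x∈)  = ne-var x∈
  Neutral⇒Ne (napp n m) = ne-app (Neutral⇒Ne n) (LNF⇒Nf m)

mutual
  Ne-unclose : ∀ {Δ Ψ x κx κ} k M → Ne Δ Ψ (closeAt k x M) κ → Ψ ∋ᵇ k ∶ κx → Ne ((x , κx) ∷ Δ) Ψ M κ
  Ne-unclose {x = x} k (fvar y) n p with x ≟ y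
  Ne-unclose k (fvar y) (ne-bvar q) p | yes refl with ∋ᵇ-functional q p
  ... | refl = ne-var (here refl)
  Ne-unclose k (fvar y) (ne-var y∈) p | no _ = ne-var (there y∈)
  Ne-unclose k (bvar i)  (ne-bvar q)  p = ne-bvar q
  Ne-unclose k (app t u) (ne-app n m) p = ne-app (Ne-unclose k t n p) (Nf-unclose k u m p)

  Nf-unclose : ∀ {Δ Ψ x κx κ} k M → Nf Δ Ψ (closeAt k x M) κ → Ψ ∋ᵇ k ∶ κx → Nf ((x , κx) ∷ Δ) Ψ M κ
  Nf-unclose {x = x} k (fvar y) n p with x ≟ y
  Nf-unclose k (fvar y) (nf-ne (ne-bvar q)) p | yes refl with ∋ᵇ-functional q p
  ... | refl = nf-ne (ne-var (here refl))
  Nf-unclose k (fvar y) (nf-ne (ne-var y∈)) p | no _ = nf-ne (ne-var (there y∈))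
  Nf-unclose k (bvar i)  (nf-ne n)  p = nf-ne (Ne-unclose k (bvar i) n p)
  Nf-unclose k (app t u) (nf-ne n)  p = nf-ne (Ne-unclose k (app t u) n p)
  Nf-unclose k (lam t)   (nf-lam m) p = nf-lam (Nf-unclose (suc k) t m (bs p))

mutual
  Ne-fv : ∀ {Δ Ψ t κ z} → Ne Δ Ψ t κ → z ∈ fv t → z ∈ names Δ
  Ne-fv (ne-var x∈) (here refl) = names-∈ x∈
  Ne-fv {t = app t u} (ne-app n m) z∈ with ∈-++⁻ (fv t) z∈
  ... | inj₁ z∈t = Ne-fv n z∈t
  ... | inj₂ z∈u = Nf-fv m z∈u

  Nf-fv : ∀ {Δ Ψ t κ z} → Nf Δ Ψ t κ → z ∈ fv t → z ∈ names Δ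
  Nf-fv (nf-ne n)  = Ne-fv n
  Nf-fv (nf-lam m) = Nf-fv m

module _ {Q : Set} where

  mutual
    ≈-∶∶ : ∀ {τ τ' : KTy Q} {κ} → τ ≈ τ' → τ' ∶∶ₖ κ → τ ∶∶ₖ κ
    ≈-∶∶ base≈                 base∶∶ₖ            = base∶∶ₖ
    ≈-∶∶ (arr≈ A⊆B _ σ≈τ) (arr∶∶ₖ B∶∶κ τ∶∶κ') = arr∶∶ₖ (≈*-∶∶ A⊆B B∶∶κ) (≈-∶∶ σ≈τ τ∶∶κ')

    ≈*-∶∶ : ∀ {A B : List (KTy Q)} {κ} → All (λ a → Any (a ≈_) B) A → All (_∶∶ₖ κ) B → All (_∶∶ₖ κ) A
    ≈*-∶∶ []         _     = []
    ≈*-∶∶ (a≈ ∷ A⊆B) B∶∶κ = ≈-Any-∶∶ a≈ B∶∶κ ∷ ≈*-∶∶ A⊆B B∶∶κ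

    ≈-Any-∶∶ : ∀ {a : KTy Q} {B κ} → Any (a ≈_) B → All (_∶∶ₖ κ) B → a ∶∶ₖ κ
    ≈-Any-∶∶ (here a≈b) (b∶∶κ ∷ _)    = ≈-∶∶ a≈b b∶∶κ
    ≈-Any-∶∶ (there a≈) (_ ∷ B∶∶κ)   = ≈-Any-∶∶ a≈ B∶∶κ

  ⊢ₖ-∶∶ : ∀ {K : KCtx Q} {t τ κ} → K ⊢ₖ t ∶ τ ∶∶ κ → τ ∶∶ₖ κ
  ⊢ₖ-∶∶ (kax (_ , refines) x∈ τ'∈ τ≈τ') = ≈-∶∶ τ≈τ' (All.lookup (All.lookup refines x∈) τ'∈)
  ⊢ₖ-∶∶ (kapp d _) with ⊢ₖ-∶∶ d
  ... | arr∶∶ₖ _ σ∶∶κ' = σ∶∶κ'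
  ⊢ₖ-∶∶ (klam d) with ⊢ₖ-wf d
  ... | _ , A∶∶κ ∷ _ = arr∶∶ₖ A∶∶κ (⊢ₖ-∶∶ d)

  mutual
    ≈⇒≼ : ∀ {τ τ' : KTy Q} {κ} → τ ≈ τ' → τ ∶∶ₖ κ → τ' ∶∶ₖ κ → τ ≼ τ'
    ≈⇒≼ base≈ _ _ = base≼
    ≈⇒≼ (arr≈ A⊆B _ σ≈τ) r@(arr∶∶ₖ A∶∶κ σ∶∶κ') r'@(arr∶∶ₖ B∶∶κ τ∶∶κ') =
      arr≼ r r' (≈⇒≼ σ≈τ σ∶∶κ' τ∶∶κ') (≈*⇒≼∧ A⊆B A∶∶κ B∶∶κ)

    ≈⇒≽ : ∀ {τ τ' : KTy Q} {κ} → τ ≈ τ' → τ ∶∶ₖ κ → τ' ∶∶ₖ κ → τ' ≼ τ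
    ≈⇒≽ base≈ _ _ = base≼
    ≈⇒≽ (arr≈ _ B⊆A σ≈τ) r@(arr∶∶ₖ A∶∶κ σ∶∶κ') r'@(arr∶∶ₖ B∶∶κ τ∶∶κ') =
      arr≼ r' r (≈⇒≽ σ≈τ σ∶∶κ' τ∶∶κ') (≈*⇒≽∧ B⊆A B∶∶κ A∶∶κ)

    ≈*⇒≼∧ : ∀ {A B : List (KTy Q)} {κ} → All (λ a → Any (a ≈_) B) A →
            All (_∶∶ₖ κ) A → All (_∶∶ₖ κ) B → A ≼∧ B
    ≈*⇒≼∧ []         _                B∶∶κ = []
    ≈*⇒≼∧ (a≈ ∷ A⊆B) (a∶∶κ ∷ A∶∶κ) B∶∶κ = ≈-Any⇒≽ a≈ a∶∶κ B∶∶κ ∷ ≈*⇒≼∧ A⊆B A∶∶κ B∶∶κ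

    ≈-Any⇒≽ : ∀ {a : KTy Q} {B κ} → Any (a ≈_) B → a ∶∶ₖ κ → All (_∶∶ₖ κ) B → Any (_≼ a) B
    ≈-Any⇒≽ (here a≈b) a∶∶κ (b∶∶κ ∷ _)  = here (≈⇒≽ a≈b a∶∶κ b∶∶κ)
    ≈-Any⇒≽ (there a≈) a∶∶κ (_ ∷ B∶∶κ) = there (≈-Any⇒≽ a≈ a∶∶κ B∶∶κ)

    ≈*⇒≽∧ : ∀ {A B : List (KTy Q)} {κ} → All (λ b → Any (_≈ b) A) B →
            All (_∶∶ₖ κ) B → All (_∶∶ₖ κ) A → B ≼∧ A
    ≈*⇒≽∧ []         _                A∶∶κ = []
    ≈*⇒≽∧ (≈b ∷ B⊆A) (b∶∶κ ∷ B∶∶κ) A∶∶κ = Any-≈⇒≼ ≈b b∶∶κ A∶∶κ ∷ ≈*⇒≽∧ B⊆A B∶∶κ A∶∶κ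

    Any-≈⇒≼ : ∀ {b : KTy Q} {A κ} → Any (_≈ b) A → b ∶∶ₖ κ → All (_∶∶ₖ κ) A → Any (_≼ b) A
    Any-≈⇒≼ (here a≈b) b∶∶κ (a∶∶κ ∷ _)  = here (≈⇒≼ a≈b a∶∶κ b∶∶κ)
    Any-≈⇒≼ (there ≈b) b∶∶κ (_ ∷ A∶∶κ) = there (Any-≈⇒≼ ≈b b∶∶κ A∶∶κ)

  mutual
    ≼-trans : ∀ (b : KTy Q) {a c κ} → a ∶∶ₖ κ → c ∶∶ₖ κ → a ≼ b → b ≼ c → a ≼ c
    ≼-trans (kbase q) _ _ base≼ base≼ = base≼
    ≼-trans (B ⇒ₖ τ) r@(arr∶∶ₖ A∶∶κ σ∶∶κ') r'@(arr∶∶ₖ C∶∶κ ρ∶∶κ') (arr≼ _ _ σ≼τ A≼B) (arr≼ _ _ τ≼ρ B≼C) =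
      arr≼ r r' (≼-trans τ σ∶∶κ' ρ∶∶κ' σ≼τ τ≼ρ) (≼∧-trans B A∶∶κ C∶∶κ A≼B B≼C)

    ≼∧-trans : ∀ (B : List (KTy Q)) {A C κ} → All (_∶∶ₖ κ) A → All (_∶∶ₖ κ) C →
               A ≼∧ B → B ≼∧ C → A ≼∧ C
    ≼∧-trans B _               _    []          _   = []
    ≼∧-trans B (a∶∶κ ∷ A∶∶κ) C∶∶κ (b≼a ∷ A≼B) B≼C =
      Any-≼-trans B a∶∶κ C∶∶κ b≼a B≼C ∷ ≼∧-trans B A∶∶κ C∶∶κ A≼B B≼C

    Any-≼-trans : ∀ (B : List (KTy Q)) {a C κ} → a ∶∶ₖ κ → All (_∶∶ₖ κ) C →
                  Any (_≼ a) B → B ≼∧ C → Any (_≼ a) C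
    Any-≼-trans (b ∷ B) a∶∶κ C∶∶κ (here b≼a)  (c≼b ∷ _)  = ≼-Any-trans b a∶∶κ C∶∶κ b≼a c≼b
    Any-≼-trans (b ∷ B) a∶∶κ C∶∶κ (there b≼a) (_ ∷ B≼C) = Any-≼-trans B a∶∶κ C∶∶κ b≼a B≼C

    ≼-Any-trans : ∀ (b : KTy Q) {a C κ} → a ∶∶ₖ κ → All (_∶∶ₖ κ) C →
                  b ≼ a → Any (_≼ b) C → Any (_≼ a) C
    ≼-Any-trans b a∶∶κ (c∶∶κ ∷ _)  b≼a (here c≼b)  = here (≼-trans b c∶∶κ a∶∶κ c≼b b≼a)
    ≼-Any-trans b a∶∶κ (_ ∷ C∶∶κ) b≼a (there c≼b) = there (≼-Any-trans b a∶∶κ C∶∶κ b≼a c≼b)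

  names-sdomK : ∀ (Γ : KCtx Q) → names (sdomK Γ) ≡ names Γ
  names-sdomK Γ = sym (map-∘ Γ)

  ∈-sdomK : ∀ {Γ : KCtx Q} {x A κ} → (x , A , κ) ∈ Γ → (x , κ) ∈ sdomK Γ
  ∈-sdomK (here refl) = here refl
  ∈-sdomK (there x∈)  = there (∈-sdomK x∈)

  Ne-kind : ∀ {Γ : KCtx Q} {Ψ M κ τ κ'} → Ne (sdomK Γ) Ψ M κ → Γ ⊢ₖ M ∶ τ ∶∶ κ' → κ ≡ κ'
  Ne-kind {Γ} (ne-var x∈) (kax (u , _) x∈' _ _) =
    lookup-functional (subst Unique (sym (names-sdomK Γ)) u) x∈ (∈-sdomK x∈')
  Ne-kind (ne-app n _) (kapp d _) with Ne-kind n d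
  ... | refl = refl

module _ {Q : Set} where

  ⊢-≡ : ∀ {Γ : QCtx Q} {M M' σ κ} → M ≡ M' → Γ ⊢ M ∶ σ ∶∶ κ → Γ ⊢ M' ∶ σ ∶∶ κ
  ⊢-≡ refl d = d

  ⊢-ctx-≡ : ∀ {Γ Γ' : QCtx Q} {M σ κ} → Γ ≡ Γ' → Γ ⊢ M ∶ σ ∶∶ κ → Γ' ⊢ M ∶ σ ∶∶ κ
  ⊢-ctx-≡ refl d = d

  left∧* : ∀ {x p κ Γ M σ κ'} → ((x , p , κ) ∷ Γ) ⊢ M ∶ σ ∶∶ κ' →
           ((x , ⋀ (asList {Q} p) , κ) ∷ Γ) ⊢ M ∶ σ ∶∶ κ'
  left∧* {p = lin τ} d = left∧ d
  left∧* {p = ⋀ A}   d = d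

  contr* : ∀ {y z x p p' κ Γ M σ κ'} → x ∉ names Γ → ((y , p , κ) ∷ (z , p' , κ) ∷ Γ) ⊢ M ∶ σ ∶∶ κ' →
           ((x , ⋀ (asList {Q} p ++ asList p') , κ) ∷ Γ) ⊢ substTm y (fvar x) (substTm z (fvar x) M) ∶ σ ∶∶ κ'
  contr* x∉ d = contr x∉ (left∧* (exch (left∧* (exch (left∧* d) (swap _ _ ↭-refl))) (swap _ _ ↭-refl)))

  renameᶜ : (ℕ → ℕ) → QCtx Q → QCtx Q
  renameᶜ r = map (map₁ r)

  names-renameᶜ : ∀ r (Γ : QCtx Q) → names (renameᶜ r Γ) ≡ map r (names Γ)
  names-renameᶜ r Γ = trans (sym (map-∘ Γ)) (map-∘ Γ)

  renameᶜ-toInt : ∀ r (Γ : QCtx Q) → renameᶜ r (toInt Γ) ≡ toInt (renameᶜ r Γ)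
  renameᶜ-toInt r Γ = trans (sym (map-∘ Γ)) (map-∘ Γ)

  renameᶜ-merge : ∀ r (Γ Δ : QCtx Q) → renameᶜ r (merge Γ Δ) ≡ merge (renameᶜ r Γ) (renameᶜ r Δ)
  renameᶜ-merge r []      Δ       = refl
  renameᶜ-merge r (_ ∷ Γ) []      = refl
  renameᶜ-merge r (_ ∷ Γ) (_ ∷ Δ) = cong (_ ∷_) (renameᶜ-merge r Γ Δ)

  sdomQ-renameᶜ : ∀ r (Γ Δ : QCtx Q) → sdomQ Γ ≡ sdomQ Δ → sdomQ (renameᶜ r Γ) ≡ sdomQ (renameᶜ r Δ)
  sdomQ-renameᶜ r []      []      _  = refl
  sdomQ-renameᶜ r (_ ∷ Γ) (_ ∷ Δ) eq with ∷-injectiveˡ eq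
  ... | refl = cong (_ ∷_) (sdomQ-renameᶜ r Γ Δ (∷-injectiveʳ eq))

  module _ {r : ℕ → ℕ} (r-inj : Injective _≡_ _≡_ r) where

    ∉-renameᶜ : ∀ {x} {Γ : QCtx Q} → x ∉ names Γ → r x ∉ names (renameᶜ r Γ)
    ∉-renameᶜ {x} {Γ} x∉ rx∈ with ∈-map⁻ r (subst (r x ∈_) (names-renameᶜ r Γ) rx∈)
    ... | y , y∈ , rx≡ry = x∉ (subst (_∈ names Γ) (sym (r-inj rx≡ry)) y∈)

    msub-rename-substTm : ∀ x P M → msub (fvar ∘ r) (substTm x P M) ≡
                          substTm (r x) (msub (fvar ∘ r) P) (msub (fvar ∘ r) M)
    msub-rename-substTm x P M = begin
      msub (fvar ∘ r) (substTm x P M)                 ≡⟨ msub-substTm (fvar ∘ r) x P M ⟩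
      msub ((fvar ∘ r) [ x ≔ P' ]) M                  ≡⟨ msub-cong M (λ z _ → pointwise z) ⟩
      msub (msub (fvar [ r x ≔ P' ]) ∘ fvar ∘ r) M    ≡⟨ msub-∘ _ (fvar ∘ r) M ⟨
      msub (fvar [ r x ≔ P' ]) (msub (fvar ∘ r) M)    ≡⟨ substTm≡msub (r x) P' (msub (fvar ∘ r) M) ⟨
      substTm (r x) P' (msub (fvar ∘ r) M)            ∎
      where
      open ≡-Reasoning
      P' = msub (fvar ∘ r) P
      pointwise : ∀ z → ((fvar ∘ r) [ x ≔ P' ]) z ≡ (fvar [ r x ≔ P' ]) (r z)
      pointwise z with x ≟ z
      ... | yes refl = sym (update-≡ fvar (r x) P')
      ... | no  x≢z  = sym (update-≢ fvar P' (x≢z ∘ r-inj))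

    msub-rename-Λ : ∀ x M → msub (fvar ∘ r) (Λ x M) ≡ Λ (r x) (msub (fvar ∘ r) M)
    msub-rename-Λ x M = cong lam (msub-closeAt 0 M refl (λ { y _ y≢x (here rx≡ry) → y≢x (sym (r-inj rx≡ry)) }))

    mutual
      ⊢-rename : ∀ {Γ M σ κ} → Γ ⊢ M ∶ σ ∶∶ κ → renameᶜ r Γ ⊢ msub (fvar ∘ r) M ∶ σ ∶∶ κ
      ⊢-rename ax         = ax
      ⊢-rename (left∧ d)  = left∧ (⊢-rename d)
      ⊢-rename (right∧ c) = right∧ (Conj-rename c)
      ⊢-rename right∧∅    = right∧∅
      ⊢-rename (left→ {Γ₁} {Γ₂} {N} {x = x} {M = M} {f = f} d₁ d₂ Γ₁#Γ₂ f∉Γ₁ f∉Γ₂) =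
        ⊢-ctx-≡ (sym (trans (map-++ _ Γ₁ _) (cong (renameᶜ r Γ₁ ++_) (map-++ _ Γ₂ _))))
          (⊢-≡ (sym (msub-rename-substTm x (app (fvar f) N) M))
            (left→ (⊢-rename d₁) (⊢-rename d₂)
              (subst (All _) (sym (names-renameᶜ r Γ₁)) (All.map⁺ (All.map (∉-renameᶜ {Γ = Γ₂}) Γ₁#Γ₂)))
              (∉-renameᶜ f∉Γ₁) (∉-renameᶜ f∉Γ₂)))
      ⊢-rename (right→ {x = x} {M = M} d) = ⊢-≡ (sym (msub-rename-Λ x M)) (right→ (⊢-rename d))
      ⊢-rename (weak x∉ d) = weak (∉-renameᶜ x∉) (⊢-rename d)
      ⊢-rename (contr {x = x} {y} {z} {M = M} x∉ d) =
        ⊢-≡ (sym (trans (msub-rename-substTm y (fvar x) (substTm z (fvar x) M))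
                        (cong (substTm (r y) (fvar (r x))) (msub-rename-substTm z (fvar x) M))))
          (contr (∉-renameᶜ x∉) (⊢-rename d))
      ⊢-rename (exch d Γ↭Γ') = exch (⊢-rename d) (↭.map⁺ _ Γ↭Γ')

      Conj-rename : ∀ {M κ Γ A} → Conj M κ Γ A → Conj (msub (fvar ∘ r) M) κ (renameᶜ r Γ) A
      Conj-rename (one {Γ} d) = subst (λ Γ' → Conj _ _ Γ' _) (sym (renameᶜ-toInt r Γ)) (one (⊢-rename d))
      Conj-rename (more {Γ} {Δ} d c eq) =
        subst (λ Γ' → Conj _ _ Γ' _) (sym (renameᶜ-merge r Γ Δ))
          (more (⊢-rename d) (Conj-rename c) (sdomQ-renameᶜ r Γ Δ eq))

unshift : ℕ → List ℕ → Tm → Tm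
unshift c []       T = T
unshift c (y ∷ ys) T = unshift c ys (substTm (c + y) (fvar y) T)

unshift-msub : ∀ c ys s M → unshift c ys (msub s M) ≡ msub (unshift c ys ∘ s) M
unshift-msub c []       s M = refl
unshift-msub c (y ∷ ys) s M =
  trans (cong (unshift c ys) (substTm-msub (c + y) (fvar y) s M)) (unshift-msub c ys _ M)

unshift-fvar-below : ∀ c ys {w} → w < c → unshift c ys (fvar w) ≡ fvar w
unshift-fvar-below c []       w<c = refl
unshift-fvar-below c (y ∷ ys) {w} w<c with (c + y) ≟ w
... | yes c+y≡w = ⊥-elim (<-irrefl refl (<-≤-trans w<c (subst (c ≤_) c+y≡w (m≤m+n c y))))
... | no  _     = unshift-fvar-below c ys w<c

unshift-fvar-shifted : ∀ c ys {z} → z ∈ ys → z < c → unshift c ys (fvar (c + z)) ≡ fvar z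
unshift-fvar-shifted c (y ∷ ys) {z} z∈ z<c with (c + y) ≟ (c + z)
... | yes c+y≡c+z =
  trans (cong (unshift c ys ∘ fvar) (+-cancelˡ-≡ c y z c+y≡c+z)) (unshift-fvar-below c ys z<c)
unshift-fvar-shifted c (y ∷ ys) (here refl) z<c | no c+y≢c+y = ⊥-elim (c+y≢c+y refl)
unshift-fvar-shifted c (y ∷ ys) (there z∈)  z<c | no _       = unshift-fvar-shifted c ys z∈ z<c

unshift-substTm : ∀ c ys x f N P → f < c → (∀ {z} → z ∈ fv N → z ∈ ys × z < c) → (∀ {z} → z ∈ fv P → z < c) →
                  unshift c ys (substTm x (app (fvar f) (msub (fvar ∘ (c +_)) N)) P) ≡ substTm x (app (fvar f) N) P
unshift-substTm c ys x f N P f<c N-shifted P<c = begin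
  unshift c ys (substTm x fN' P)            ≡⟨ cong (unshift c ys) (msub-identity (substTm x fN' P)) ⟨
  unshift c ys (msub fvar (substTm x fN' P)) ≡⟨ unshift-msub c ys fvar (substTm x fN' P) ⟩
  msub ρ (substTm x fN' P)                  ≡⟨ msub-substTm ρ x fN' P ⟩
  msub (ρ [ x ≔ msub ρ fN' ]) P
    ≡⟨ msub-cong P (λ z z∈ → update-cong x _ z (unshift-fvar-below c ys (P<c z∈))) ⟩
  msub (fvar [ x ≔ msub ρ fN' ]) P          ≡⟨ cong (λ V → msub (fvar [ x ≔ V ]) P) ρfN'≡fN ⟩
  msub (fvar [ x ≔ app (fvar f) N ]) P      ≡⟨ substTm≡msub x (app (fvar f) N) P ⟨
  substTm x (app (fvar f) N) P              ∎
  where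
  open ≡-Reasoning
  fN' = app (fvar f) (msub (fvar ∘ (c +_)) N)
  ρ = unshift c ys ∘ fvar
  ρfN'≡fN : msub ρ fN' ≡ app (fvar f) N
  ρfN'≡fN = cong₂ app (unshift-fvar-below c ys f<c)
    (trans (msub-∘ ρ (fvar ∘ (c +_)) N)
      (trans (msub-cong N (λ z z∈ → unshift-fvar-shifted c ys (proj₁ (N-shifted z∈)) (proj₂ (N-shifted z∈))))
        (msub-identity N)))

-- (2) Lifting Kobayashi derivations

module _ {Q : Set} where

  Approxᶜ : QCtx Q → KCtx Q → Set
  Approxᶜ = Pointwise Approx

  Approxᶜ-names : ∀ {Γ̂ : QCtx Q} {Γ} → Approxᶜ Γ̂ Γ → names Γ̂ ≡ names Γ
  Approxᶜ-names []                           = refl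
  Approxᶜ-names ((refl , refl , _ , _) ∷ ≈s) = cong (_ ∷_) (Approxᶜ-names ≈s)

  Approxᶜ-sdom : ∀ {Γ̂ : QCtx Q} {Γ} → Approxᶜ Γ̂ Γ → sdomQ Γ̂ ≡ sdomK Γ
  Approxᶜ-sdom []                           = refl
  Approxᶜ-sdom ((refl , refl , _ , _) ∷ ≈s) = cong (_ ∷_) (Approxᶜ-sdom ≈s)

  Approxᶜ-toInt : ∀ {Γ̂ : QCtx Q} {Γ} → Approxᶜ Γ̂ Γ → Approxᶜ (toInt Γ̂) Γ
  Approxᶜ-toInt [] = []
  Approxᶜ-toInt {(_ , p , _) ∷ _} ((refl , refl , p∶∶κ , p≼A) ∷ ≈s) =
    (refl , refl , asList-∶∶ {p = p} p∶∶κ , p≼A) ∷ Approxᶜ-toInt ≈s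

  Approxᶜ-merge : ∀ {Γ̂₁ Γ̂₂ : QCtx Q} {Γ} → Approxᶜ Γ̂₁ Γ → Approxᶜ Γ̂₂ Γ → Approxᶜ (merge Γ̂₁ Γ̂₂) Γ
  Approxᶜ-merge [] [] = []
  Approxᶜ-merge {(_ , p , _) ∷ _} {(_ , p' , _) ∷ _}
                ((refl , refl , p∶∶κ , p≼A) ∷ ≈s) ((refl , refl , p'∶∶κ , p'≼A) ∷ ≈s') =
    (refl , refl , All.++⁺ (asList-∶∶ {p = p} p∶∶κ) (asList-∶∶ {p = p'} p'∶∶κ) ,
     subst (_≼∧ _) (sym (⌊⌋*-++ (asList p) (asList p'))) (All.++⁺ p≼A p'≼A)) ∷ Approxᶜ-merge ≈s ≈s'

  emptyᶜ : KCtx Q → QCtx Q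
  emptyᶜ = map (λ { (x , _ , κ) → (x , ⋀ [] , κ) })

  Approxᶜ-emptyᶜ : ∀ (Γ : KCtx Q) → Approxᶜ (emptyᶜ Γ) Γ
  Approxᶜ-emptyᶜ []      = []
  Approxᶜ-emptyᶜ (_ ∷ Γ) = (refl , refl , [] , []) ∷ Approxᶜ-emptyᶜ Γ

  weaken* : ∀ (Γ : KCtx Q) {Γ₀ M σ κ} → Unique (names Γ) → All (_∉ names Γ₀) (names Γ) →
            Γ₀ ⊢ M ∶ σ ∶∶ κ → (emptyᶜ Γ ++ Γ₀) ⊢ M ∶ σ ∶∶ κ
  weaken* []            _       _           d = d
  weaken* ((x , _) ∷ Γ) {Γ₀} (x∉Γ ∷ u) (x∉Γ₀ ∷ Γ#Γ₀) d = weak x∉ (weaken* Γ u Γ#Γ₀ d)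
    where
    x∉ : x ∉ names (emptyᶜ Γ ++ Γ₀)
    x∉ x∈ with ∈-++⁻ (names (emptyᶜ Γ)) (subst (x ∈_) (names-++ (emptyᶜ Γ) Γ₀) x∈)
    ... | inj₁ x∈Γ  = Unique[x∷xs]⇒x∉xs (x∉Γ ∷ u) (subst (x ∈_) (sym (map-∘ Γ)) x∈Γ)
    ... | inj₂ x∈Γ₀ = x∉Γ₀ x∈Γ₀

  record Focus (g : ℕ) (B : List (KTy Q)) (κ : SType) (Γ̂ : QCtx Q) (Γ : KCtx Q) : Set where
    constructor focused
    field
      before : QCtx Q
      p      : QPre Q
      after  : QCtx Q
      beforeₖ afterₖ : KCtx Q
      Γ̂≡ : Γ̂ ≡ before ++ (g , p , κ) ∷ after
      Γ≡ : Γ ≡ beforeₖ ++ (g , B , κ) ∷ afterₖ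
      before-approx : Approxᶜ before beforeₖ
      after-approx  : Approxᶜ after afterₖ
      p-approx      : Approx (g , p , κ) (g , B , κ)

  focus : ∀ {g B κ} {Γ̂ : QCtx Q} {Γ} → (g , B , κ) ∈ Γ → Approxᶜ Γ̂ Γ → Focus g B κ Γ̂ Γ
  focus {Γ̂ = (_ , p , _) ∷ Γ̂} {_ ∷ Γ} (here refl) (e≈@(refl , refl , _) ∷ ≈s) =
    focused [] p Γ̂ [] Γ refl refl [] ≈s e≈
  focus {Γ̂ = ê ∷ _} {e ∷ _} (there g∈) (e≈ ∷ ≈s) with focus g∈ ≈s
  ... | focused before p after beforeₖ afterₖ Γ̂≡ Γ≡ before≈ after≈ p≈ =
    focused (ê ∷ before) p after (e ∷ beforeₖ) afterₖ (cong (ê ∷_) Γ̂≡) (cong (e ∷_) Γ≡) (e≈ ∷ before≈) after≈ p≈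

  absorb : ∀ {Γ̂ : QCtx Q} {Γ g B κ σ̂ x P α κ''} → Approxᶜ Γ̂ Γ → (g , B , κ) ∈ Γ →
           σ̂ ∶∶ κ → Any (_≼ ⌊ σ̂ ⌋) B → ((x , lin σ̂ , κ) ∷ Γ̂) ⊢ P ∶ α ∶∶ κ'' →
           ∃ λ Γ̂' → Approxᶜ Γ̂' Γ × Γ̂' ⊢ substTm x (fvar g) P ∶ α ∶∶ κ''
  absorb {g = g} {κ = κ} {σ̂} {x} {P} Γ̂≈Γ g∈ σ̂∶∶κ B∋≼σ̂ d with focus g∈ Γ̂≈Γ
  ... | focused before p after _ _ Γ̂≡ Γ≡ before≈ after≈ (_ , _ , p∶∶κ , p≼B) =
    before ++ merged ∷ after ,
    subst (Approxᶜ _) (sym Γ≡)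
      (Pointwise.++⁺ before≈ ((refl , refl , σ̂∶∶κ ∷ asList-∶∶ {p = p} p∶∶κ , B∋≼σ̂ ∷ p≼B) ∷ after≈)) ,
    exch (⊢-≡ (cong (substTm x (fvar g)) (substTm-self g P)) (contr* g∉ d₁)) (↭-sym (↭.shift merged before after))
    where
    merged = (g , ⋀ (σ̂ ∷ asList p) , κ)
    d₁ : ((x , lin σ̂ , κ) ∷ (g , p , κ) ∷ (before ++ after)) ⊢ P ∶ _ ∶∶ _
    d₁ = exch (⊢-ctx-≡ (cong (_ ∷_) Γ̂≡) d) (prep _ (↭.shift (g , p , κ) before after))
    g∉ : g ∉ names (before ++ after)
    g∉ = Unique[x∷xs]⇒x∉xs (AllPairs.tail (proj₁ (proj₁ (⊢-wf d₁))))

  contract-shifted : ∀ c (Γ₁ Γ₂ Γ' : QCtx Q) {T α κ} → sdomQ Γ₁ ≡ sdomQ Γ₂ →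
                     (renameᶜ (c +_) Γ₁ ++ Γ₂ ++ Γ') ⊢ T ∶ α ∶∶ κ →
                     (merge Γ₁ Γ₂ ++ Γ') ⊢ unshift c (names Γ₁) T ∶ α ∶∶ κ
  contract-shifted c [] [] Γ' _ d = d
  contract-shifted c ((y , p , κ) ∷ Γ₁) ((_ , p' , _) ∷ Γ₂) Γ' {T} same-dom d with ∷-injectiveˡ same-dom
  ... | refl =
    exch (⊢-ctx-≡ (sym (++-assoc (merge Γ₁ Γ₂) Γ' (m ∷ [])))
           (contract-shifted c Γ₁ Γ₂ (Γ' ++ m ∷ []) (∷-injectiveʳ same-dom) m-moved-last))
         (↭-sym (↭.∷↭∷ʳ m (merge Γ₁ Γ₂ ++ Γ')))
    where
    X = renameᶜ (c +_) Γ₁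
    R = Γ₂ ++ Γ'
    m = (y , ⋀ (asList p ++ asList p') , κ)
    d₁ : ((c + y , p , κ) ∷ (y , p' , κ) ∷ (X ++ R)) ⊢ T ∶ _ ∶∶ _
    d₁ = exch d (prep _ (↭.shift (y , p' , κ) X R))
    y∉ : y ∉ names (X ++ R)
    y∉ = Unique[x∷xs]⇒x∉xs (AllPairs.tail (proj₁ (proj₁ (⊢-wf d₁))))
    merged : (m ∷ (X ++ R)) ⊢ substTm (c + y) (fvar y) T ∶ _ ∶∶ _
    merged = ⊢-≡ (cong (substTm (c + y) (fvar y)) (substTm-self y T)) (contr* y∉ d₁)
    m-moved-last : (X ++ Γ₂ ++ Γ' ++ m ∷ []) ⊢ substTm (c + y) (fvar y) T ∶ _ ∶∶ _
    m-moved-last = ⊢-ctx-≡ (trans (++-assoc X R (m ∷ [])) (cong (X ++_) (++-assoc Γ₂ Γ' (m ∷ []))))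
                     (exch merged (↭.∷↭∷ʳ m (X ++ R)))

  names-sdomQ : ∀ (Γ : QCtx Q) → names (sdomQ Γ) ≡ names Γ
  names-sdomQ Γ = sym (map-∘ Γ)

  -- Left → needs disjoint contexts: the context of N is renamed apart by y ↦ c + y, with c
  -- above every name in sight, and each c + y is then contracted back into y.
  left→-shared : ∀ {Γ̂₁ Γ̂₂ : QCtx Q} {N Â κ x σ̂ κ' P α κ'' f} →
    sdomQ Γ̂₁ ≡ sdomQ Γ̂₂ → (∀ {z} → z ∈ fv N → z ∈ names Γ̂₁) → f ∉ names Γ̂₂ →
    Γ̂₁ ⊢ N ∶ ⋀ Â ∶∶ κ → ((x , lin σ̂ , κ') ∷ Γ̂₂) ⊢ P ∶ α ∶∶ κ'' →
    (merge Γ̂₁ Γ̂₂ ++ (f , lin (Â ⇒ σ̂) , κ ↣ κ') ∷ []) ⊢ substTm x (app (fvar f) N) P ∶ α ∶∶ κ''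
  left→-shared {Γ̂₁} {Γ̂₂} {N} {x = x} {P = P} {f = f} same-dom fvN⊆ f∉Γ̂₂ d₁ d₂ =
    ⊢-≡ (unshift-substTm c (names Γ̂₁) x f N P f<c N-shifted P<c)
      (contract-shifted c Γ̂₁ Γ̂₂ _ same-dom
        (left→ (⊢-rename (λ {a} {b} → +-cancelˡ-≡ c a b) d₁) d₂ shifted#Γ̂₂ (shifted-∉ f<c) f∉Γ̂₂))
    where
    bound = strictUpperBound (names Γ̂₂ ++ fv P ++ f ∷ [])
    c = proj₁ bound
    Γ̂₂<c : ∀ {z} → z ∈ names Γ̂₂ → z < c
    Γ̂₂<c = All.lookup (proj₂ bound) ∘ ∈-++⁺ˡ
    P<c : ∀ {z} → z ∈ fv P → z < c
    P<c = All.lookup (proj₂ bound) ∘ ∈-++⁺ʳ (names Γ̂₂) ∘ ∈-++⁺ˡ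
    f<c : f < c
    f<c = All.lookup (proj₂ bound) (∈-++⁺ʳ (names Γ̂₂) (∈-++⁺ʳ (fv P) (here refl)))
    same-names : names Γ̂₁ ≡ names Γ̂₂
    same-names = trans (sym (names-sdomQ Γ̂₁)) (trans (cong names same-dom) (names-sdomQ Γ̂₂))
    N-shifted : ∀ {z} → z ∈ fv N → z ∈ names Γ̂₁ × z < c
    N-shifted z∈ = fvN⊆ z∈ , Γ̂₂<c (subst (_ ∈_) same-names (fvN⊆ z∈))
    shifted-∉ : ∀ {w} → w < c → w ∉ names (renameᶜ (c +_) Γ̂₁)
    shifted-∉ w<c w∈ with ∈-map⁻ (c +_) (subst (_ ∈_) (names-renameᶜ (c +_) Γ̂₁) w∈)
    ... | y , _ , refl = <-irrefl refl (<-≤-trans w<c (m≤m+n c y))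
    shifted#Γ̂₂ : All (_∉ names Γ̂₂) (names (renameᶜ (c +_) Γ̂₁))
    shifted#Γ̂₂ = All.tabulate (λ w∈ w∈Γ̂₂ → shifted-∉ (Γ̂₂<c w∈Γ̂₂) w∈)

  record QLift (Γ : KCtx Q) (t : Tm) (τ : KTy Q) (κ : SType) : Set where
    constructor qlift
    field
      Γ̂          : QCtx Q
      τ̂          : QTy Q
      approx     : Approxᶜ Γ̂ Γ
      refines    : τ̂ ∶∶ κ
      below      : ⌊ τ̂ ⌋ ≼ τ
      derivation : Γ̂ ⊢ t ∶ lin τ̂ ∶∶ κ

  record QLift⋀ (J : QCtx Q → List (QTy Q) → Set) (Γ : KCtx Q) (A : List (KTy Q)) (κ : SType) : Set where
    constructor qlift⋀
    field
      Γ̂          : QCtx Q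
      Â          : List (QTy Q)
      approx     : Approxᶜ Γ̂ Γ
      refines    : All (_∶∶ κ) Â
      covers     : A ≼∧ ⌊ Â ⌋*
      derivation : J Γ̂ Â

  lift-Conj : ∀ {Γ N a A κ} → QLift Γ N a κ → All (λ a → QLift Γ N a κ) A → QLift⋀ (Conj N κ) Γ (a ∷ A) κ
  lift-Conj (qlift Γ̂ τ̂ Γ̂≈Γ τ̂∶∶κ τ̂≼a d) [] =
    qlift⋀ (toInt Γ̂) (τ̂ ∷ []) (Approxᶜ-toInt Γ̂≈Γ) (τ̂∶∶κ ∷ []) (here τ̂≼a ∷ []) (one d)
  lift-Conj (qlift Γ̂ τ̂ Γ̂≈Γ τ̂∶∶κ τ̂≼a d) (l ∷ ls) with lift-Conj l ls
  ... | qlift⋀ Γ̂' Â Γ̂'≈Γ Â∶∶κ A≼Â c =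
    qlift⋀ (merge Γ̂ Γ̂') (τ̂ ∷ Â) (Approxᶜ-merge Γ̂≈Γ Γ̂'≈Γ) (τ̂∶∶κ ∷ Â∶∶κ) (here τ̂≼a ∷ All.map there A≼Â)
      (more d c (trans (Approxᶜ-sdom Γ̂≈Γ) (sym (Approxᶜ-sdom Γ̂'≈Γ))))

  lift-⋀ : ∀ {Γ N A κ} → Unique (names Γ) → All (λ a → QLift Γ N a κ) A →
           QLift⋀ (λ Γ̂ Â → Γ̂ ⊢ N ∶ ⋀ Â ∶∶ κ) Γ A κ
  lift-⋀ {Γ} u [] =
    qlift⋀ (emptyᶜ Γ) [] (Approxᶜ-emptyᶜ Γ) [] []
      (⊢-ctx-≡ (++-identityʳ (emptyᶜ Γ)) (weaken* Γ u (All.tabulate (λ _ ())) right∧∅))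
  lift-⋀ u (l ∷ ls) with lift-Conj l ls
  ... | qlift⋀ Γ̂ Â Γ̂≈Γ Â∶∶κ A≼Â c = qlift⋀ Γ̂ Â Γ̂≈Γ Â∶∶κ A≼Â (right∧ c)

  mutual
    lift : ∀ {Γ : KCtx Q} {t τ κ Ψ} → Γ ⊢ₖ t ∶ τ ∶∶ κ → Nf (sdomK Γ) Ψ t κ → QLift Γ t τ κ
    lift {Γ} {t} d (nf-ne n) with ⊢ₖ-∶∶ d
    ... | base∶∶ₖ {q} =
      let (Γ̂ , Γ̂≈Γ , d') = lift-neutral d n base∶∶ base≼ (Approxᶜ-emptyᶜ Γ) x₀∶q
      in qlift Γ̂ (base q) Γ̂≈Γ base∶∶ base≼ (⊢-≡ (trans (substTm≡msub x₀ t (fvar x₀)) (update-≡ fvar x₀ t)) d')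
      where
      x₀ = proj₁ (fresh (names Γ))
      x₀∶q : ((x₀ , lin (base q) , o) ∷ emptyᶜ Γ) ⊢ fvar x₀ ∶ lin (base q) ∶∶ o
      x₀∶q = exch (weaken* Γ (proj₁ (⊢ₖ-wf d)) (All.tabulate (λ { x∈ (here refl) → proj₂ (fresh (names Γ)) x∈ })) ax)
                  (↭-sym (↭.∷↭∷ʳ _ (emptyᶜ Γ)))
    lift (klam {M = M} d) (nf-lam m) with lift d (Nf-unclose 0 M m bz)
    ... | qlift ((_ , p , _) ∷ Γ̂) σ̂ ((refl , refl , p∶∶κ , p≼A) ∷ Γ̂≈Γ) σ̂∶∶κ' σ̂≼σ dM =
      qlift Γ̂ (asList p ⇒ σ̂) Γ̂≈Γ τ̂∶∶ (arr≼ (⌊⌋-∶∶ τ̂∶∶) (⊢ₖ-∶∶ (klam d)) σ̂≼σ p≼A) (right→ (left∧* dM))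
      where
      τ̂∶∶ = arr∶∶ (asList-∶∶ {p = p} p∶∶κ) σ̂∶∶κ'

    lift* : ∀ {Γ : KCtx Q} {N A κ Ψ} → All (λ a → Γ ⊢ₖ N ∶ a ∶∶ κ) A → Nf (sdomK Γ) Ψ N κ →
            All (λ a → QLift Γ N a κ) A
    lift* []       m = []
    lift* (d ∷ ds) m = lift d m ∷ lift* ds m

    lift-neutral : ∀ {Γ : KCtx Q} {M τ κ Ψ} → Γ ⊢ₖ M ∶ τ ∶∶ κ → Ne (sdomK Γ) Ψ M κ →
      ∀ {σ̂ x Γ̂ P α κ''} → σ̂ ∶∶ κ → τ ≼ ⌊ σ̂ ⌋ → Approxᶜ Γ̂ Γ → ((x , lin σ̂ , κ) ∷ Γ̂) ⊢ P ∶ α ∶∶ κ'' →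
      ∃ λ Γ̂' → Approxᶜ Γ̂' Γ × Γ̂' ⊢ substTm x M P ∶ α ∶∶ κ''
    lift-neutral (kax {τ = τ} (_ , refines) g∈ τ'∈ τ≈τ') (ne-var _) σ̂∶∶κ τ≼σ̂ Γ̂≈Γ dP =
      absorb Γ̂≈Γ g∈ σ̂∶∶κ (lose τ'∈ (≼-trans τ τ'∶∶κ (⌊⌋-∶∶ σ̂∶∶κ) (≈⇒≽ τ≈τ' (≈-∶∶ τ≈τ' τ'∶∶κ) τ'∶∶κ) τ≼σ̂)) dP
      where
      τ'∶∶κ = All.lookup (All.lookup refines g∈) τ'∈
    lift-neutral (kapp dM ds) (ne-app nM nN) σ̂∶∶κ τ≼σ̂ Γ̂≈Γ dP with Ne-kind nM dM
    ... | refl = lift-app dM nM (lift-⋀ (proj₁ (⊢ₖ-wf dM)) (lift* ds nN)) (Nf-fv nN) σ̂∶∶κ τ≼σ̂ Γ̂≈Γ dP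

    lift-app : ∀ {Γ : KCtx Q} {M N A τ κ κ' Ψ} → Γ ⊢ₖ M ∶ (A ⇒ₖ τ) ∶∶ (κ ↣ κ') → Ne (sdomK Γ) Ψ M (κ ↣ κ') →
      QLift⋀ (λ Γ̂ Â → Γ̂ ⊢ N ∶ ⋀ Â ∶∶ κ) Γ A κ → (∀ {z} → z ∈ fv N → z ∈ names (sdomK Γ)) →
      ∀ {σ̂ x Γ̂ P α κ''} → σ̂ ∶∶ κ' → τ ≼ ⌊ σ̂ ⌋ → Approxᶜ Γ̂ Γ → ((x , lin σ̂ , κ') ∷ Γ̂) ⊢ P ∶ α ∶∶ κ'' →
      ∃ λ Γ̂' → Approxᶜ Γ̂' Γ × Γ̂' ⊢ substTm x (app M N) P ∶ α ∶∶ κ''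
    lift-app {Γ} {M} {N} dM nM (qlift⋀ Γ̂N Â Γ̂N≈Γ Â∶∶κ A≼Â dN) fvN {σ̂} {x} {Γ̂} {P} σ̂∶∶κ' τ≼σ̂ Γ̂≈Γ dP =
      Product.map₂ (Product.map₂ (⊢-≡ f-substituted))
        (lift-neutral dM nM Â⇒σ̂∶∶ (arr≼ (⊢ₖ-∶∶ dM) (⌊⌋-∶∶ Â⇒σ̂∶∶) τ≼σ̂ A≼Â) (Approxᶜ-merge Γ̂N≈Γ Γ̂≈Γ)
          (exch (left→-shared same-dom fvN⊆ f∉Γ̂ dN dP) (↭-sym (↭.∷↭∷ʳ _ (merge Γ̂N Γ̂)))))
      where
      f = proj₁ (fresh (names Γ ++ fv P ++ fv N))
      f∉ = proj₂ (fresh (names Γ ++ fv P ++ fv N))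
      f-substituted : substTm f M (substTm x (app (fvar f) N) P) ≡ substTm x (app M N) P
      f-substituted = substTm-app-fresh {x = x} {M} {N} {P}
        (f∉ ∘ ∈-++⁺ʳ (names Γ) ∘ ∈-++⁺ˡ) (f∉ ∘ ∈-++⁺ʳ (names Γ) ∘ ∈-++⁺ʳ (fv P))
      Â⇒σ̂∶∶ = arr∶∶ Â∶∶κ σ̂∶∶κ'
      same-dom : sdomQ Γ̂N ≡ sdomQ Γ̂
      same-dom = trans (Approxᶜ-sdom Γ̂N≈Γ) (sym (Approxᶜ-sdom Γ̂≈Γ))
      fvN⊆ : ∀ {z} → z ∈ fv N → z ∈ names Γ̂N
      fvN⊆ = subst (_ ∈_) (trans (names-sdomK Γ) (sym (Approxᶜ-names Γ̂N≈Γ))) ∘ fvN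
      f∉Γ̂ : f ∉ names Γ̂
      f∉Γ̂ = f∉ ∘ ∈-++⁺ˡ ∘ subst (f ∈_) (Approxᶜ-names Γ̂≈Γ)

theorem1 : (k : ℕ) →
    ((Γ : QCtx (Fin k)) (t : Tm) (σ : QPre (Fin k)) (κ : SType) →
       LNF (sdomQ Γ) t κ →
       Γ ⊢ t ∶ σ ∶∶ κ →
       ⌊ Γ ⌋ᶜ ⊢ₖ t ∶⌊ σ ⌋∶∶ κ)
    ×
    ((Γ : KCtx (Fin k)) (t : Tm) (τ : KTy (Fin k)) (κ : SType) →
       LNF (sdomK Γ) t κ →
       Γ ⊢ₖ t ∶ τ ∶∶ κ →
       Σ (QCtx (Fin k)) (λ Γ̂ → Σ (QTy (Fin k)) (λ τ̂ →
         Pointwise Approx Γ̂ Γ × τ̂ ∶∶ κ × ⌊ τ̂ ⌋ ≼ τ × Γ̂ ⊢ t ∶ lin τ̂ ∶∶ κ)))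
theorem1 k = (λ _ _ _ _ _ → collapse) , λ _ _ _ _ t-lnf d →
  let qlift Γ̂ τ̂ Γ̂≈Γ τ̂∶∶κ τ̂≼τ d̂ = lift d (LNF⇒Nf t-lnf) in Γ̂ , τ̂ , Γ̂≈Γ , τ̂∶∶κ , τ̂≼τ , d̂
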